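{- Let $n \geq k \geq 4$ be integers. Let $D_n$ be the directed graph obtained from the Crown Subgraph $\mathcal{C}_n$ (vertex set $\{1,\dots,5n-10\}$) by adding one new vertex $v$, the $n$ incoming edges $(v,2i-1)$ labelled $i$ for $i=1,\dots,n$, and $n$ outgoing edges ending at $v$, labelled $1,\dots,n$, with tails: vertex $5n-10$ for label $1$; vertex $1$ for label $2$; vertex $2n-1$ for label $n-1$; vertex $2n$ for label $n$; vertex $5n-9-3i$ for label $i+2$ ($i=1,\dots,\lfloor\frac{n-4}{2}\rfloor$); and vertex $2n-1+3i$ for label $n-1-i$ ($i=1,\dots,\lceil\frac{n-4}{2}\rceil$). Then $D_n$ has exactly $n$ directed Hamiltonian cycles. Moreover, if $S\subseteq\{1,\dots,n\}$ with $|S| = n-k$ and, for each $i\in S$, one deletes from $D_n$ the incoming edge labelled $i$, or the outgoing edge labelled $i$, or both, then the resulting directed graph (a broken crown graph $\mathcal{B}_{n,k}$) has $5n-9$ vertices and exactly $k$ directed Hamiltonian cycles.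
   Context: All graphs are directed; a Hamiltonian cycle is a directed cycle visiting every vertex exactly once. For an integer $n\ge 4$, the Crown Subgraph $\mathcal{C}_n$ is the directed graph on vertex set $\{1,2,\dots,5n-10\}$ with the following directed edges: $(i,i+1)$ and $(i+1,i)$ for all $i=1,\dots,5n-11$; $(1,5n-10)$ and $(5n-10,1)$; $(2n,2n-2)$ and $(5n-10,2)$; $(2n+3i,\,2n-2-2i)$ for all $i=1,\dots,\lceil \frac{n-4}{2}\rceil$; and $(5n-10-3i,\,2i+2)$ for all $i=1,\dots,\lfloor \frac{n-4}{2}\rfloor$. -}

module Defs where

open import Data.Nat using (ℕ; zero; suc; _+_; _*_; _∸_; _≤_; ⌊_/2⌋; ⌈_/2⌉)
open import Data.Fin using (Fin; toℕ)
open import Data.Fin.Subset using (Subset; _∈_)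
open import Data.Vec using (Vec; lookup)
open import Data.List using (List; length)
open import Data.List.Relation.Unary.All using (All)
open import Data.List.Relation.Unary.Unique.Propositional using (Unique)
import Data.List.Membership.Propositional as LMem
open import Data.Product using (Σ; ∃; _×_)
open import Data.Unit using (⊤)
open import Data.Empty using (⊥)
open import Relation.Nullary using (¬_)
open import Relation.Binary.PropositionalEquality using (_≡_)

Digraph : ℕ → Set₁
Digraph N = Fin N → Fin N → Set

iter : ∀ {A : Set} → (A → A) → ℕ → A → A
iter f zero    x = x
iter f (suc k) x = f (iter f k x)

-- A directed Hamiltonian cycle, represented by its successor table s
-- (s[i] is the vertex following i on the cycle): every (i, s[i]) is an
-- edge, s is injective, and the orbit of any vertex reaches every vertex
-- (so s is a single cyclic permutation of all vertices).  The successor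
-- table is exactly the edge set of the cycle, so distinct tables are
-- distinct cycles.
IsHamCycle : ∀ {N} → Digraph N → Vec (Fin N) N → Set
IsHamCycle {N} E s =
  (∀ i → E i (lookup s i)) ×
  (∀ i j → lookup s i ≡ lookup s j → i ≡ j) ×
  (∀ i j → ∃ λ k → iter (lookup s) k i ≡ j)

HasExactlyHamCycles : ∀ {N} → Digraph N → ℕ → Set
HasExactlyHamCycles {N} E m =
  Σ (List (Vec (Fin N) N)) λ cs →
    length cs ≡ m × Unique cs × All (IsHamCycle E) cs ×
    (∀ s → IsHamCycle E s → s LMem.∈ cs)

data CrownEdge (n : ℕ) (a b : ℕ) : Set where
  fwd   : ∀ i → 1 ≤ i → i ≤ 5 * n ∸ 11 → a ≡ i → b ≡ suc i → CrownEdge n a b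
  bwd   : ∀ i → 1 ≤ i → i ≤ 5 * n ∸ 11 → a ≡ suc i → b ≡ i → CrownEdge n a b
  wrapF : a ≡ 1 → b ≡ 5 * n ∸ 10 → CrownEdge n a b
  wrapB : a ≡ 5 * n ∸ 10 → b ≡ 1 → CrownEdge n a b
  extA  : a ≡ 2 * n → b ≡ 2 * n ∸ 2 → CrownEdge n a b
  extB  : a ≡ 5 * n ∸ 10 → b ≡ 2 → CrownEdge n a b
  chordA : ∀ i → 1 ≤ i → i ≤ ⌈ n ∸ 4 /2⌉ →
           a ≡ 2 * n + 3 * i → b ≡ 2 * n ∸ 2 ∸ 2 * i → CrownEdge n a b
  chordB : ∀ i → 1 ≤ i → i ≤ ⌊ n ∸ 4 /2⌋ →
           a ≡ 5 * n ∸ 10 ∸ 3 * i → b ≡ 2 * i + 2 → CrownEdge n a b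

-- D_n: the new vertex v is encoded as 0; crown vertices keep their names.

data OutTail (n : ℕ) (l t : ℕ) : Set where
  lab1  : l ≡ 1 → t ≡ 5 * n ∸ 10 → OutTail n l t
  lab2  : l ≡ 2 → t ≡ 1 → OutTail n l t
  labn1 : l ≡ n ∸ 1 → t ≡ 2 * n ∸ 1 → OutTail n l t
  labn  : l ≡ n → t ≡ 2 * n → OutTail n l t
  labA  : ∀ i → 1 ≤ i → i ≤ ⌊ n ∸ 4 /2⌋ →
          l ≡ i + 2 → t ≡ 5 * n ∸ 9 ∸ 3 * i → OutTail n l t
  labB  : ∀ i → 1 ≤ i → i ≤ ⌈ n ∸ 4 /2⌉ →
          l ≡ n ∸ 1 ∸ i → t ≡ 2 * n ∸ 1 + 3 * i → OutTail n l t

data DArc (n : ℕ) (a b : ℕ) : Set where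
  crown  : CrownEdge n a b → DArc n a b
  inArc  : ∀ l → 1 ≤ l → l ≤ n → a ≡ 0 → b ≡ 2 * l ∸ 1 → DArc n a b
  outArc : ∀ l → 1 ≤ l → l ≤ n → OutTail n l a → b ≡ 0 → DArc n a b

nV : ℕ → ℕ
nV n = 5 * n ∸ 9

-- D_n as a digraph on Fin (5n-9): Fin index 0 is v, index j ≥ 1 is crown vertex j.
D : (n : ℕ) → Digraph (nV n)
D n a b = DArc n (toℕ a) (toℕ b)

-- Broken crown graphs.  Labels 1..n are encoded by j : Fin n via l = 1 + toℕ j.

data Mode : Set where
  delIn delOut delBoth : Mode

DelIn : Mode → Set
DelIn delIn   = ⊤
DelIn delOut  = ⊥
DelIn delBoth = ⊤

DelOut : Mode → Set
DelOut delIn   = ⊥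
DelOut delOut  = ⊤
DelOut delBoth = ⊤

InDeleted : ∀ {n} → Subset n → (Fin n → Mode) → ℕ → Set
InDeleted {n} S mode l = Σ (Fin n) λ j → suc (toℕ j) ≡ l × j ∈ S × DelIn (mode j)

OutDeleted : ∀ {n} → Subset n → (Fin n → Mode) → ℕ → Set
OutDeleted {n} S mode l = Σ (Fin n) λ j → suc (toℕ j) ≡ l × j ∈ S × DelOut (mode j)

Kept : ∀ {n a b} → Subset n → (Fin n → Mode) → DArc n a b → Set
Kept S mode (crown _)              = ⊤
Kept S mode (inArc l _ _ _ _)      = ¬ InDeleted S mode l
Kept S mode (outArc l _ _ _ _)     = ¬ OutDeleted S mode l

-- B_{n,k} (k determined by |S| = n-k): D_n with the selected labelled edges deleted.
B : (n : ℕ) → Subset n → (Fin n → Mode) → Digraph (nV n)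
B n S mode a b = Σ (DArc n (toℕ a) (toℕ b)) (Kept S mode)

module Submission where

open import Defs
open import Data.Nat using (ℕ; _≤_; _∸_)
open import Data.Fin using (Fin)
open import Data.Fin.Subset using (Subset; ∣_∣)
open import Data.Product using (_×_)
open import Relation.Binary.PropositionalEquality using (_≡_)
open import Data.Nat
open import Data.Nat.Properties
open import Data.Nat.DivMod using (_%_; m<n⇒m%n≡m; [m+kn]%n≡m%n; m*n%n≡0)
open import Data.Nat.Tactic.RingSolver
open import Data.Bool using (Bool; true; false; if_then_else_)
open import Data.Unit using (⊤; tt)
open import Data.Empty
open import Data.Product using (Σ; ∃; _,_; proj₁; proj₂)
open import Data.Sum using (_⊎_; inj₁; inj₂; [_,_])
open import Data.Fin as Fin using (toℕ; fromℕ<; punchOut)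
open import Data.Fin.Properties using (toℕ-injective; toℕ<n; toℕ-fromℕ<; punchOut-injective; injective⇒≤)
  renaming (_≟_ to _≟ᶠ_; suc-injective to Fin-suc-injective)
open import Data.Fin.Subset using (inside; outside; ∁) renaming (_∈_ to _∈ₛ_; ⊥ to ∅)
open import Data.Fin.Subset.Properties using (∉⊥; ∣⊥∣≡0; x∉p⇒x∈∁p; x∈∁p⇒x∉p; ∣∁p∣≡n∸∣p∣)
open import Data.Vec using (Vec; lookup; tabulate; []; _∷_; here; there)
open import Data.Vec.Properties using (lookup∘tabulate; tabulate∘lookup; tabulate-cong)
open import Data.List using (List; []; _∷_; map; length)
open import Data.List.Properties using (length-map)
open import Data.List.Membership.Propositional using (_∈_)
open import Data.List.Membership.Propositional.Properties using (∈-map⁺; ∈-map⁻)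
open import Data.List.Relation.Unary.Any using (here; there)
open import Data.List.Relation.Unary.All as All using (All)
import Data.List.Relation.Unary.All.Properties as All
open import Data.List.Relation.Unary.AllPairs using ([]; _∷_)
open import Data.List.Relation.Unary.Unique.Propositional using (Unique)
import Data.List.Relation.Unary.Unique.Propositional.Properties as Unique
open import Relation.Nullary
open import Relation.Binary.PropositionalEquality hiding ([_])

-- Write n = 4 + m and let v be vertex 0.  A Hamiltonian cycle leaves v along the in-edge of
-- some label l + 1, i.e. to the odd vertex 1 + 2l.  The crown vertices 1 .. 2n-1 carry only
-- path edges (besides the wrap edge at 1 and the out-edges at 1 and 2n-1), so the cycle runs
-- through them in two monotone stretches meeting next to 1 + 2l; the even vertex there that the
-- stretches miss has to be entered by a chord.  The vertices 2n .. 5n-10 can only be entered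
-- along path edges or the wrap edge, so there the cycle again moves monotonically, and the positions
-- of chords and tails (spaced by 3) leave exactly one way to close it: the cycle hamCycle l, which
-- uses the in- and the out-edge of label l + 1.  Conversely each hamCycle l is Hamiltonian, so
-- D n has exactly n Hamiltonian cycles, and deleting an edge of a label in S destroys exactly the
-- cycle of that label.

≡∸⇒+≡ : ∀ {a b c} → b ≤ a → c ≡ a ∸ b → c + b ≡ a
≡∸⇒+≡ b≤a refl = m∸n+n≡m b≤a

+≡⇒≡∸ : ∀ {a b c} → c + b ≡ a → c ≡ a ∸ b
+≡⇒≡∸ {b = b} {c} refl = sym (m+n∸n≡m c b)

3*m≢r+3*n : ∀ a b {r} → 1 ≤ r → r < 3 → 3 * a ≢ r + 3 * b
3*m≢r+3*n a b {r} 1≤r r<3 e = <⇒≢ 1≤r (sym r≡0)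
  where
  r≡0 : r ≡ 0
  r≡0 = begin
    r                 ≡⟨ m<n⇒m%n≡m r<3 ⟨
    r % 3             ≡⟨ [m+kn]%n≡m%n r b 3 ⟨
    (r + b * 3) % 3   ≡⟨ cong (λ z → (r + z) % 3) (*-comm b 3) ⟩
    (r + 3 * b) % 3   ≡⟨ cong (_% 3) e ⟨
    3 * a % 3         ≡⟨ cong (_% 3) (*-comm 3 a) ⟩
    a * 3 % 3         ≡⟨ m*n%n≡0 a 3 ⟩
    0                 ∎
    where open ≡-Reasoning

≡0⇒≤ : ∀ {a b} → a ≡ 0 → a ≤ b
≡0⇒≤ refl = z≤n

1+2*-injective : ∀ a b → 1 + 2 * a ≡ 1 + 2 * b → a ≡ b
1+2*-injective a b e = *-cancelˡ-≡ a b 2 (suc-injective e)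

2[1+l]∸1≡1+2l : ∀ l → 2 * suc l ∸ 1 ≡ 1 + 2 * l
2[1+l]∸1≡1+2l l = cong (_∸ 1) (*-distribˡ-+ 2 1 l)

iter-+ : ∀ (g : ℕ → ℕ) a b x → iter g (a + b) x ≡ iter g a (iter g b x)
iter-+ g zero b x = refl
iter-+ g (suc a) b x = cong g (iter-+ g a b x)

Reaches : (ℕ → ℕ) → ℕ → ℕ → Set
Reaches g x y = ∃ λ k → iter g k x ≡ y

reaches-refl : ∀ {g x} → Reaches g x x
reaches-refl = 0 , refl

reaches-trans : ∀ {g x y z} → Reaches g x y → Reaches g y z → Reaches g x z
reaches-trans {g} {x} (a , refl) (b , refl) = b + a , iter-+ g b a x

reaches-step : ∀ {g x y} → g x ≡ y → Reaches g x y
reaches-step e = 1 , e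

reaches-within-cycle : ∀ {g o x y} → Reaches g o x → Reaches g o y → (∃ λ q → iter g (suc q) o ≡ o) → Reaches g x y
reaches-within-cycle {g} {o} {x} (a , ea) (b , eb) (q , eq) = b + (a * suc q ∸ a) , (begin
  iter g (b + (a * suc q ∸ a)) x      ≡⟨ iter-+ g b (a * suc q ∸ a) x ⟩
  iter g b (iter g (a * suc q ∸ a) x) ≡⟨ cong (iter g b) back-to-o ⟩
  iter g b o                          ≡⟨ eb ⟩
  _                                   ∎)
  where
  open ≡-Reasoning
  laps : ∀ a → iter g (a * suc q) o ≡ o
  laps zero = refl
  laps (suc a) = trans (iter-+ g (suc q) (a * suc q) o) (trans (cong (iter g (suc q)) (laps a)) eq)
  back-to-o : iter g (a * suc q ∸ a) x ≡ o
  back-to-o = begin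
    iter g (a * suc q ∸ a) x                ≡⟨ cong (iter g (a * suc q ∸ a)) ea ⟨
    iter g (a * suc q ∸ a) (iter g a o)     ≡⟨ iter-+ g (a * suc q ∸ a) a o ⟨
    iter g (a * suc q ∸ a + a) o            ≡⟨ cong (λ k → iter g k o) (m∸n+n≡m (m≤m*n a (suc q))) ⟩
    iter g (a * suc q) o                    ≡⟨ laps a ⟩
    o                                       ∎

ascending⇒reaches : ∀ {g} a b → (∀ x → a ≤ x → x < b → g x ≡ suc x) → a ≤ b → Reaches g a b
ascending⇒reaches {g} a b H a≤b = go (b ∸ a) a ≤-refl (m+[n∸m]≡n a≤b)
  where
  go : ∀ d x → a ≤ x → x + d ≡ b → Reaches g x b
  go zero x _ e = 0 , trans (sym (+-identityʳ x)) e
  go (suc d) x ax e = reaches-trans (reaches-step (H x ax (≤-trans (s≤s (m≤m+n x d)) (≤-reflexive (trans (sym (+-suc x d)) e)))))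
                              (go d (suc x) (≤-trans ax (n≤1+n x)) (trans (sym (+-suc x d)) e))

descending⇒reaches : ∀ {g} a b → (∀ y → a ≤ y → y < b → g (suc y) ≡ y) → a ≤ b → Reaches g b a
descending⇒reaches {g} a b H a≤b = go (b ∸ a) b (≤-reflexive (sym (m+[n∸m]≡n a≤b))) ≤-refl a≤b
  where
  go : ∀ d x → x ≤ a + d → x ≤ b → a ≤ x → Reaches g x a
  go d x xle xb ax with m≤n⇒m<n∨m≡n ax
  ... | inj₂ refl = reaches-refl
  ... | inj₁ lt with x | d
  ...   | suc x' | suc d' = reaches-trans (reaches-step (H x' (≤-pred lt) xb)) (go d' x' (≤-pred (subst (suc x' ≤_) (+-suc a d') xle)) (≤-trans (n≤1+n x') xb) (≤-pred lt))
  ...   | suc x' | zero = ⊥-elim (<⇒≱ lt (subst (suc x' ≤_) (+-identityʳ a) xle))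

-- If G identified two points, a section of G that avoids one of them would inject Fin (suc n) into Fin n.
surjective⇒injective : ∀ {N} (G : Fin N → Fin N) → (∀ j → ∃ λ i → G i ≡ j) → ∀ x y → G x ≡ G y → x ≡ y
surjective⇒injective {zero} G surj ()
surjective⇒injective {suc n} G surj x y Gx≡Gy with x ≟ᶠ y
... | yes x≡y = x≡y
... | no x≢y = ⊥-elim (1+n≰n (injective⇒≤ {f = h} h-injective))
  where
  section : Fin (suc n) → Fin (suc n)
  section j with proj₁ (surj j) ≟ᶠ y
  ... | yes _ = x
  ... | no _ = proj₁ (surj j)
  G∘section : ∀ j → G (section j) ≡ j
  G∘section j with proj₁ (surj j) ≟ᶠ y
  ... | yes p = trans Gx≡Gy (trans (cong G (sym p)) (proj₂ (surj j)))
  ... | no _ = proj₂ (surj j)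
  y≢section : ∀ j → y ≢ section j
  y≢section j with proj₁ (surj j) ≟ᶠ y
  ... | yes _ = λ q → x≢y (sym q)
  ... | no q = λ r → q (sym r)
  h : Fin (suc n) → Fin n
  h j = punchOut (y≢section j)
  h-injective : ∀ {a b} → h a ≡ h b → a ≡ b
  h-injective {a} {b} q = trans (sym (G∘section a)) (trans (cong G (punchOut-injective (y≢section a) (y≢section b) q)) (G∘section b))

orbit⇒surjective : ∀ {N} (G : Fin N → Fin N) → (∀ i j → ∃ λ k → iter G k i ≡ j) → ∀ j → ∃ λ i → G i ≡ j
orbit⇒surjective G orbit j with orbit (G j) j
... | zero , e = j , e
... | suc k , e = iter G k (G j) , e

toℕ-iter : ∀ {N} (G : Fin N → Fin N) (g : ℕ → ℕ) → (∀ i → toℕ (G i) ≡ g (toℕ i)) →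
           ∀ k i → toℕ (iter G k i) ≡ iter g k (toℕ i)
toℕ-iter G g G≗g zero i = refl
toℕ-iter G g G≗g (suc k) i = trans (G≗g (iter G k i)) (cong g (toℕ-iter G g G≗g k i))

elements : ∀ {n} → Subset n → List (Fin n)
elements [] = []
elements (inside ∷ p) = Fin.zero ∷ map Fin.suc (elements p)
elements (outside ∷ p) = map Fin.suc (elements p)

length-elements : ∀ {n} (p : Subset n) → length (elements p) ≡ ∣ p ∣
length-elements [] = refl
length-elements (inside ∷ p) = cong suc (trans (length-map Fin.suc (elements p)) (length-elements p))
length-elements (outside ∷ p) = trans (length-map Fin.suc (elements p)) (length-elements p)

∈-elements⁺ : ∀ {n} {p : Subset n} {x} → x ∈ₛ p → x ∈ elements p
∈-elements⁺ {p = inside ∷ p} here = here refl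
∈-elements⁺ {p = inside ∷ p} (there x∈p) = there (∈-map⁺ Fin.suc (∈-elements⁺ x∈p))
∈-elements⁺ {p = outside ∷ p} (there x∈p) = ∈-map⁺ Fin.suc (∈-elements⁺ x∈p)

∈-elements⁻ : ∀ {n} {p : Subset n} {x} → x ∈ elements p → x ∈ₛ p
∈-elements⁻ {p = inside ∷ p} (here refl) = here
∈-elements⁻ {p = inside ∷ p} (there x∈) with ∈-map⁻ Fin.suc x∈
... | _ , y∈ , refl = there (∈-elements⁻ y∈)
∈-elements⁻ {p = outside ∷ p} x∈ with ∈-map⁻ Fin.suc x∈
... | _ , y∈ , refl = there (∈-elements⁻ y∈)

elements-unique : ∀ {n} (p : Subset n) → Unique (elements p)
elements-unique [] = []
elements-unique (inside ∷ p) = All.tabulate zero∉ ∷ Unique.map⁺ Fin-suc-injective (elements-unique p)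
  where
  zero∉ : ∀ {y} → y ∈ map Fin.suc (elements p) → Fin.zero ≢ y
  zero∉ y∈ refl with ∈-map⁻ Fin.suc y∈
  ... | _ , _ , ()
elements-unique (outside ∷ p) = Unique.map⁺ Fin-suc-injective (elements-unique p)

isHamCycle-mono : ∀ {N} {E E′ : Digraph N} → (∀ {a b} → E a b → E′ a b) → ∀ {s} → IsHamCycle E s → IsHamCycle E′ s
isHamCycle-mono E⊆E′ (edges , injective , orbit) = (λ i → E⊆E′ (edges i)) , injective , orbit

hasExactlyHamCycles-cong : ∀ {N} {E E′ : Digraph N} → (∀ {a b} → E a b → E′ a b) → (∀ {a b} → E′ a b → E a b) →
                           ∀ {k} → HasExactlyHamCycles E k → HasExactlyHamCycles E′ k
hasExactlyHamCycles-cong {E = E} {E′} E⊆E′ E′⊆E (cs , length≡ , unique , hams , complete) =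
  cs , length≡ , unique , All.map (λ {s} → isHamCycle-mono {E = E} {E′} E⊆E′ {s}) hams ,
  λ s H → complete s (isHamCycle-mono {E = E′} {E} E′⊆E {s} H)

-- The graph for n = 4 + m, with every vertex name and label brought into a normal form
-- (no truncated subtraction); the outgoing edge with label l + 1 is described by Tail l.
module Normalised (m : ℕ) where
  n : ℕ
  n = 4 + m

  chordsA chordsB : ℕ
  chordsA = ⌈ m /2⌉
  chordsB = ⌊ m /2⌋

  chordsB+chordsA≡m : chordsB + chordsA ≡ m
  chordsB+chordsA≡m = ⌊n/2⌋+⌈n/2⌉≡n m

  chordsA≤m : chordsA ≤ m
  chordsA≤m = ⌈n/2⌉≤n m

  chordsB≤m : chordsB ≤ m
  chordsB≤m = ⌊n/2⌋≤n m

  -- the crown vertex 5n-10; vertex 0 is v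
  M : ℕ
  M = 10 + 5 * m

  data Tail (l x : ℕ) : Set where
    tail₁   : l ≡ 0 → x ≡ 10 + 5 * m → Tail l x
    tail₂   : l ≡ 1 → x ≡ 1 → Tail l x
    tailₙ₋₁ : l ≡ 2 + m → x ≡ 7 + 2 * m → Tail l x
    tailₙ   : l ≡ 3 + m → x ≡ 8 + 2 * m → Tail l x
    tailA   : ∀ i → suc i ≤ chordsB → l ≡ suc (suc i) → x + 3 * suc i ≡ 11 + 5 * m → Tail l x
    tailB   : ∀ i → suc i ≤ chordsA → l + suc i ≡ 2 + m → x ≡ 7 + 2 * m + 3 * suc i → Tail l x

  data Arc (x y : ℕ) : Set where
    step⁺   : 1 ≤ x → x < 10 + 5 * m → y ≡ suc x → Arc x y
    step⁻   : 1 ≤ y → y < 10 + 5 * m → x ≡ suc y → Arc x y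
    wrap⁺   : x ≡ 1 → y ≡ 10 + 5 * m → Arc x y
    wrap⁻   : x ≡ 10 + 5 * m → y ≡ 1 → Arc x y
    extA′   : x ≡ 8 + 2 * m → y ≡ 6 + 2 * m → Arc x y
    extB′   : x ≡ 10 + 5 * m → y ≡ 2 → Arc x y
    chordA′ : ∀ i → suc i ≤ chordsA → x ≡ 8 + 2 * m + 3 * suc i → y + 2 * suc i ≡ 6 + 2 * m → Arc x y
    chordB′ : ∀ i → suc i ≤ chordsB → x + 3 * suc i ≡ 10 + 5 * m → y ≡ 2 + 2 * suc i → Arc x y
    enter   : ∀ l → l ≤ 3 + m → x ≡ 0 → y ≡ 1 + 2 * l → Arc x y
    leave   : ∀ l → l ≤ 3 + m → Tail l x → y ≡ 0 → Arc x y

  5n∸9≡ : 5 * n ∸ 9 ≡ 11 + 5 * m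
  5n∸9≡ = cong (_∸ 9) (*-distribˡ-+ 5 4 m)

  5n∸10≡ : 5 * n ∸ 10 ≡ 10 + 5 * m
  5n∸10≡ = cong (_∸ 10) (*-distribˡ-+ 5 4 m)

  5n∸11≡ : 5 * n ∸ 11 ≡ 9 + 5 * m
  5n∸11≡ = cong (_∸ 11) (*-distribˡ-+ 5 4 m)

  2n≡ : 2 * n ≡ 8 + 2 * m
  2n≡ = *-distribˡ-+ 2 4 m

  2n∸1≡ : 2 * n ∸ 1 ≡ 7 + 2 * m
  2n∸1≡ = cong (_∸ 1) 2n≡

  2n∸2≡ : 2 * n ∸ 2 ≡ 6 + 2 * m
  2n∸2≡ = cong (_∸ 2) 2n≡

  3i≤M : ∀ {i} → i ≤ m → 3 * i ≤ 10 + 5 * m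
  3i≤M {i} i≤m = ≤-trans (*-monoʳ-≤ 3 i≤m) (≤-trans (*-monoˡ-≤ m (s≤s (s≤s (s≤s (z≤n {2}))))) (m≤n+m (5 * m) 10))

  2i≤6+2m : ∀ {i} → i ≤ m → 2 * i ≤ 6 + 2 * m
  2i≤6+2m i≤m = ≤-trans (*-monoʳ-≤ 2 i≤m) (m≤n+m (2 * m) 6)

  toTail : ∀ {l t} → OutTail n (suc l) t → Tail l t
  toTail (lab1 refl t≡) = tail₁ refl (trans t≡ 5n∸10≡)
  toTail (lab2 refl t≡) = tail₂ refl t≡
  toTail (labn1 refl t≡) = tailₙ₋₁ refl (trans t≡ 2n∸1≡)
  toTail (labn refl t≡) = tailₙ refl (trans t≡ 2n≡)
  toTail (labA (suc i) _ i≤ refl t≡) =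
    tailA i i≤ (+-comm i 2) (≡∸⇒+≡ (≤-trans (3i≤M (≤-trans i≤ chordsB≤m)) (n≤1+n _)) (trans t≡ (cong (_∸ 3 * suc i) 5n∸9≡)))
  toTail (labB (suc i) _ i≤ l≡ t≡) =
    tailB i i≤ (cong pred (≡∸⇒+≡ (≤-trans i≤ (≤-trans chordsA≤m (m≤n+m m 3))) l≡)) (trans t≡ (cong (_+ 3 * suc i) 2n∸1≡))

  toArc : ∀ {a b} → DArc n a b → Arc a b
  toArc (crown (fwd i 1≤i i≤ refl refl)) = step⁺ 1≤i (s≤s (subst (i ≤_) 5n∸11≡ i≤)) refl
  toArc (crown (bwd i 1≤i i≤ refl refl)) = step⁻ 1≤i (s≤s (subst (i ≤_) 5n∸11≡ i≤)) refl
  toArc (crown (wrapF a≡ b≡)) = wrap⁺ a≡ (trans b≡ 5n∸10≡)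
  toArc (crown (wrapB a≡ b≡)) = wrap⁻ (trans a≡ 5n∸10≡) b≡
  toArc (crown (extA a≡ b≡)) = extA′ (trans a≡ 2n≡) (trans b≡ 2n∸2≡)
  toArc (crown (extB a≡ b≡)) = extB′ (trans a≡ 5n∸10≡) b≡
  toArc (crown (chordA (suc i) _ i≤ a≡ b≡)) =
    chordA′ i i≤ (trans a≡ (cong (_+ 3 * suc i) 2n≡))
      (≡∸⇒+≡ (2i≤6+2m (≤-trans i≤ chordsA≤m)) (trans b≡ (cong (_∸ 2 * suc i) 2n∸2≡)))
  toArc (crown (chordB (suc i) _ i≤ a≡ b≡)) =
    chordB′ i i≤ (≡∸⇒+≡ (3i≤M (≤-trans i≤ chordsB≤m)) (trans a≡ (cong (_∸ 3 * suc i) 5n∸10≡)))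
      (trans b≡ (+-comm (2 * suc i) 2))
  toArc (inArc (suc l) _ (s≤s l≤) a≡ b≡) = enter l l≤ a≡ (trans b≡ (2[1+l]∸1≡1+2l l))
  toArc (outArc (suc l) _ (s≤s l≤) t b≡) = leave l l≤ (toTail t) b≡

  fromTail : ∀ {l t} → Tail l t → OutTail n (suc l) t
  fromTail (tail₁ refl t≡) = lab1 refl (trans t≡ (sym 5n∸10≡))
  fromTail (tail₂ refl t≡) = lab2 refl t≡
  fromTail (tailₙ₋₁ refl t≡) = labn1 refl (trans t≡ (sym 2n∸1≡))
  fromTail (tailₙ refl t≡) = labn refl (trans t≡ (sym 2n≡))
  fromTail (tailA i i≤ refl e) =
    labA (suc i) (s≤s z≤n) i≤ (+-comm 2 (suc i)) (trans (+≡⇒≡∸ e) (cong (_∸ 3 * suc i) (sym 5n∸9≡)))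
  fromTail (tailB i i≤ e t≡) =
    labB (suc i) (s≤s z≤n) i≤ (+≡⇒≡∸ (cong suc e)) (trans t≡ (cong (_+ 3 * suc i) (sym 2n∸1≡)))

  fromArc : ∀ {a b} → Arc a b → DArc n a b
  fromArc {a} (step⁺ 1≤x (s≤s x≤) refl) = crown (fwd _ 1≤x (subst (a ≤_) (sym 5n∸11≡) x≤) refl refl)
  fromArc {_} {b} (step⁻ 1≤y (s≤s y≤) refl) = crown (bwd _ 1≤y (subst (b ≤_) (sym 5n∸11≡) y≤) refl refl)
  fromArc (wrap⁺ a≡ b≡) = crown (wrapF a≡ (trans b≡ (sym 5n∸10≡)))
  fromArc (wrap⁻ a≡ b≡) = crown (wrapB (trans a≡ (sym 5n∸10≡)) b≡)
  fromArc (extA′ a≡ b≡) = crown (extA (trans a≡ (sym 2n≡)) (trans b≡ (sym 2n∸2≡)))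
  fromArc (extB′ a≡ b≡) = crown (extB (trans a≡ (sym 5n∸10≡)) b≡)
  fromArc (chordA′ i i≤ a≡ e) =
    crown (chordA (suc i) (s≤s z≤n) i≤ (trans a≡ (cong (_+ 3 * suc i) (sym 2n≡)))
      (trans (+≡⇒≡∸ e) (cong (_∸ 2 * suc i) (sym 2n∸2≡))))
  fromArc (chordB′ i i≤ e b≡) =
    crown (chordB (suc i) (s≤s z≤n) i≤ (trans (+≡⇒≡∸ e) (cong (_∸ 3 * suc i) (sym 5n∸10≡)))
      (trans b≡ (+-comm 2 (2 * suc i))))
  fromArc (enter l l≤ a≡ b≡) = inArc (suc l) (s≤s z≤n) (s≤s l≤) a≡ (trans b≡ (sym (2[1+l]∸1≡1+2l l)))
  fromArc (leave l l≤ t b≡) = outArc (suc l) (s≤s z≤n) (s≤s l≤) (fromTail t) b≡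

-- Crown vertices 1 .. 7+2m (that is 1 .. 2n-1) are "low", those from 8+2m = 2n on are "high":
-- low vertices only carry path edges, the wrap edge at 1 and the out-edges at 1 and 2n-1.
module ArcShapes (m : ℕ) where
  open Normalised m

  9+2m≤M : 9 + 2 * m ≤ M
  9+2m≤M = subst (9 + 2 * m ≤_) (lem m) (m≤m+n (9 + 2 * m) (1 + 3 * m))
    where lem : ∀ m → 9 + 2 * m + (1 + 3 * m) ≡ 10 + 5 * m
          lem = solve-∀

  8+2m≤M : 8 + 2 * m ≤ M
  8+2m≤M = ≤-trans (n≤1+n _) 9+2m≤M

  chordB-source≥10+2m : ∀ {x i} → x + 3 * suc i ≡ 10 + 5 * m → suc i ≤ chordsB → 10 + 2 * m ≤ x
  chordB-source≥10+2m {x} {i} e i≤ = +-cancelʳ-≤ (3 * suc i) (10 + 2 * m) x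
    (≤-trans (+-monoʳ-≤ (10 + 2 * m) (*-monoʳ-≤ 3 (≤-trans i≤ chordsB≤m))) (≤-reflexive (trans (lem m) (sym e))))
    where lem : ∀ m → 10 + 2 * m + 3 * m ≡ 10 + 5 * m
          lem = solve-∀

  tailA-source≥11+2m : ∀ {x i} → x + 3 * suc i ≡ 11 + 5 * m → suc i ≤ chordsB → 11 + 2 * m ≤ x
  tailA-source≥11+2m {x} {i} e i≤ = +-cancelʳ-≤ (3 * suc i) (11 + 2 * m) x
    (≤-trans (+-monoʳ-≤ (11 + 2 * m) (*-monoʳ-≤ 3 (≤-trans i≤ chordsB≤m))) (≤-reflexive (trans (lem m) (sym e))))
    where lem : ∀ m → 11 + 2 * m + 3 * m ≡ 11 + 5 * m
          lem = solve-∀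

  tailB-source≥8+2m : ∀ i → 8 + 2 * m ≤ 7 + 2 * m + 3 * suc i
  tailB-source≥8+2m i = subst (8 + 2 * m ≤_) (lem m i) (m≤m+n (8 + 2 * m) (2 + 3 * i))
    where lem : ∀ m i → 8 + 2 * m + (2 + 3 * i) ≡ 7 + 2 * m + 3 * suc i
          lem = solve-∀

  tail-position : ∀ {l x} → Tail l x → x ≡ 1 ⊎ x ≡ 7 + 2 * m ⊎ 8 + 2 * m ≤ x
  tail-position (tail₁ _ refl) = inj₂ (inj₂ 8+2m≤M)
  tail-position (tail₂ _ e) = inj₁ e
  tail-position (tailₙ₋₁ _ e) = inj₂ (inj₁ e)
  tail-position (tailₙ _ refl) = inj₂ (inj₂ ≤-refl)
  tail-position (tailA i i≤ _ e) = inj₂ (inj₂ (≤-trans (m≤n+m _ 3) (tailA-source≥11+2m e i≤)))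
  tail-position (tailB i _ _ refl) = inj₂ (inj₂ (tailB-source≥8+2m i))

  data Chord (x y : ℕ) : Set where
    isExtA   : x ≡ 8 + 2 * m → y ≡ 6 + 2 * m → Chord x y
    isExtB   : x ≡ 10 + 5 * m → y ≡ 2 → Chord x y
    isChordA : ∀ i → suc i ≤ chordsA → x ≡ 8 + 2 * m + 3 * suc i → y + 2 * suc i ≡ 6 + 2 * m → Chord x y
    isChordB : ∀ i → suc i ≤ chordsB → x + 3 * suc i ≡ 10 + 5 * m → y ≡ 2 + 2 * suc i → Chord x y

  arc-from-low : ∀ {x y} → 1 ≤ x → x ≤ 7 + 2 * m → Arc x y →
    suc y ≡ x ⊎ y ≡ suc x ⊎ (x ≡ 1 × y ≡ M) ⊎ (y ≡ 0 × (x ≡ 1 ⊎ x ≡ 7 + 2 * m))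
  arc-from-low _ _ (step⁺ _ _ e) = inj₂ (inj₁ e)
  arc-from-low _ _ (step⁻ _ _ e) = inj₁ (sym e)
  arc-from-low _ _ (wrap⁺ a b) = inj₂ (inj₂ (inj₁ (a , b)))
  arc-from-low _ h (wrap⁻ refl _) = ⊥-elim (≤⇒≯ h 8+2m≤M)
  arc-from-low _ h (extA′ refl _) = ⊥-elim (≤⇒≯ h ≤-refl)
  arc-from-low _ h (extB′ refl _) = ⊥-elim (≤⇒≯ h 8+2m≤M)
  arc-from-low _ h (chordA′ i _ refl _) = ⊥-elim (≤⇒≯ h (m≤m+n _ _))
  arc-from-low _ h (chordB′ i i≤ e _) = ⊥-elim (≤⇒≯ h (≤-trans (m≤n+m _ 2) (chordB-source≥10+2m e i≤)))
  arc-from-low () _ (enter _ _ refl _)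
  arc-from-low _ h (leave l _ t e) with tail-position t
  ... | inj₁ x≡ = inj₂ (inj₂ (inj₂ (e , inj₁ x≡)))
  ... | inj₂ (inj₁ x≡) = inj₂ (inj₂ (inj₂ (e , inj₂ x≡)))
  ... | inj₂ (inj₂ w) = ⊥-elim (≤⇒≯ h w)

  ArcFromHigh : ℕ → ℕ → Set
  ArcFromHigh x y = suc y ≡ x ⊎ y ≡ suc x ⊎ (x ≡ M × y ≡ 1) ⊎ Chord x y ⊎ (y ≡ 0 × ∃ λ l → l ≤ 3 + m × Tail l x)

  arc-from-high : ∀ {x y} → 8 + 2 * m ≤ x → Arc x y → ArcFromHigh x y
  arc-from-high _ (step⁺ _ _ e) = inj₂ (inj₁ e)
  arc-from-high _ (step⁻ _ _ e) = inj₁ (sym e)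
  arc-from-high (s≤s ()) (wrap⁺ refl _)
  arc-from-high _ (wrap⁻ a b) = inj₂ (inj₂ (inj₁ (a , b)))
  arc-from-high _ (extA′ a b) = inj₂ (inj₂ (inj₂ (inj₁ (isExtA a b))))
  arc-from-high _ (extB′ a b) = inj₂ (inj₂ (inj₂ (inj₁ (isExtB a b))))
  arc-from-high _ (chordA′ i i≤ a b) = inj₂ (inj₂ (inj₂ (inj₁ (isChordA i i≤ a b))))
  arc-from-high _ (chordB′ i i≤ a b) = inj₂ (inj₂ (inj₂ (inj₁ (isChordB i i≤ a b))))
  arc-from-high () (enter _ _ refl _)
  arc-from-high _ (leave l l≤ t e) = inj₂ (inj₂ (inj₂ (inj₂ (e , l , l≤ , t))))

  2+2i≤7+2m : ∀ {i} → suc i ≤ m → 2 + 2 * suc i ≤ 7 + 2 * m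
  2+2i≤7+2m i≤m = ≤-trans (+-monoʳ-≤ 2 (*-monoʳ-≤ 2 i≤m)) (m≤n+m (2 + 2 * m) 5)

  arc-into-high : ∀ {x y} → 8 + 2 * m ≤ y → Arc x y → y ≡ suc x ⊎ x ≡ suc y ⊎ (y ≡ M × x ≡ 1)
  arc-into-high _ (step⁺ _ _ e) = inj₁ e
  arc-into-high _ (step⁻ _ _ e) = inj₂ (inj₁ e)
  arc-into-high _ (wrap⁺ a b) = inj₂ (inj₂ (b , a))
  arc-into-high (s≤s ()) (wrap⁻ _ refl)
  arc-into-high h (extA′ _ refl) = ⊥-elim (≤⇒≯ (n≤1+n _) h)
  arc-into-high (s≤s (s≤s ())) (extB′ _ refl)
  arc-into-high h (chordA′ i _ _ e) = ⊥-elim (≤⇒≯ (≤-trans (m≤m+n _ _) (≤-trans (≤-reflexive e) (n≤1+n _))) h)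
  arc-into-high h (chordB′ i i≤ _ refl) = ⊥-elim (≤⇒≯ (2+2i≤7+2m (≤-trans i≤ chordsB≤m)) h)
  arc-into-high h (enter l l≤ _ refl) =
    ⊥-elim (≤⇒≯ (+-monoʳ-≤ 1 (*-monoʳ-≤ 2 l≤)) (subst (_≤ 1 + 2 * l) (cong (2 +_) (sym (*-distribˡ-+ 2 3 m))) h))
  arc-into-high () (leave _ _ _ refl)

  arc-from-v : ∀ {y} → Arc 0 y → ∃ λ l → l ≤ 3 + m × y ≡ 1 + 2 * l
  arc-from-v (step⁺ () _ _)
  arc-from-v (step⁻ _ _ ())
  arc-from-v (wrap⁺ () _)
  arc-from-v (wrap⁻ () _)
  arc-from-v (extA′ () _)
  arc-from-v (extB′ () _)
  arc-from-v (chordA′ _ _ () _)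
  arc-from-v (chordB′ i i≤ e _) = ⊥-elim (≤⇒≯ z≤n (chordB-source≥10+2m e i≤))
  arc-from-v (enter l l≤ _ e) = l , l≤ , e
  arc-from-v (leave _ _ t _) with tail-position t
  ... | inj₂ (inj₂ ())

  chord-target : ∀ {x y} → Chord x y → 2 ≤ y × y ≤ 6 + 2 * m × ∃ λ q → y ≡ 2 * q
  chord-target (isExtA _ refl) = s≤s (s≤s z≤n) , ≤-refl , 3 + m , sym (*-distribˡ-+ 2 3 m)
  chord-target (isExtB _ refl) = s≤s (s≤s z≤n) , s≤s (s≤s z≤n) , 1 , refl
  chord-target {y = y} (isChordA i i≤ _ e) =
    2≤y , ≤-trans (m≤m+n y _) (≤-reflexive e) , (3 + m) ∸ suc i , y≡
    where
    y≡ : y ≡ 2 * (3 + m ∸ suc i)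
    y≡ = begin
      y                               ≡⟨ m+n∸n≡m y (2 * suc i) ⟨
      y + 2 * suc i ∸ 2 * suc i       ≡⟨ cong (_∸ 2 * suc i) (trans e (sym (*-distribˡ-+ 2 3 m))) ⟩
      2 * (3 + m) ∸ 2 * suc i         ≡⟨ *-distribˡ-∸ 2 (3 + m) (suc i) ⟨
      2 * (3 + m ∸ suc i)             ∎
      where open ≡-Reasoning
    2≤y : 2 ≤ y
    2≤y = +-cancelʳ-≤ (2 * suc i) 2 y
      (≤-trans (+-monoʳ-≤ 2 (*-monoʳ-≤ 2 (≤-trans i≤ chordsA≤m))) (≤-trans (m≤n+m (2 + 2 * m) 4) (≤-reflexive (sym e))))
  chord-target (isChordB i i≤ _ refl) =
    s≤s (s≤s z≤n) , ≤-trans (+-monoʳ-≤ 2 (*-monoʳ-≤ 2 (≤-trans i≤ chordsB≤m))) (m≤n+m (2 + 2 * m) 4) ,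
    2 + i , sym (*-distribˡ-+ 2 1 (suc i))

  arc-target≤M : ∀ {x y} → Arc x y → y ≤ M
  arc-target≤M (step⁺ _ lt refl) = lt
  arc-target≤M (step⁻ _ lt _) = ≤-trans (n≤1+n _) lt
  arc-target≤M (wrap⁺ _ refl) = ≤-refl
  arc-target≤M (wrap⁻ _ refl) = s≤s z≤n
  arc-target≤M (extA′ _ refl) = ≤-trans (n≤1+n _) (≤-trans (n≤1+n _) 8+2m≤M)
  arc-target≤M (extB′ _ refl) = s≤s (s≤s z≤n)
  arc-target≤M (chordA′ _ _ _ e) = ≤-trans (m≤m+n _ _) (≤-trans (≤-reflexive e) (≤-trans (n≤1+n _) (≤-trans (n≤1+n _) 8+2m≤M)))
  arc-target≤M (chordB′ i i≤ _ refl) = ≤-trans (2+2i≤7+2m (≤-trans i≤ chordsB≤m)) (≤-trans (n≤1+n _) 8+2m≤M)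
  arc-target≤M (enter l l≤ _ refl) =
    ≤-trans (+-monoʳ-≤ 1 (*-monoʳ-≤ 2 l≤)) (≤-trans (≤-reflexive (cong suc (*-distribˡ-+ 2 3 m))) (≤-trans (n≤1+n _) 8+2m≤M))
  arc-target≤M (leave _ _ _ refl) = z≤n

m+1+n≡o⇒o≢m : ∀ a k {b} → a + suc k ≡ b → b ≡ a → ⊥
m+1+n≡o⇒o≢m a k p e = m+1+n≢m a (trans p e)

-- Chord sources and tails lie on progressions of step 3 from 2n - 1, 2n, 5n - 10 and 5n - 9;
-- comparing residues mod 3 tells them apart.
module TailPositions (m : ℕ) where
  open Normalised m
  open ArcShapes m

  no-tail-after-extA-source : ∀ {l} → Tail l (9 + 2 * m) → ⊥
  no-tail-after-extA-source (tail₁ _ e) = m+1+n≡o⇒o≢m (9 + 2 * m) (3 * m) (lem m) (sym e)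
    where lem : ∀ m → 9 + 2 * m + suc (3 * m) ≡ 10 + 5 * m
          lem = solve-∀
  no-tail-after-extA-source (tailₙ₋₁ _ e) = m+1+n≡o⇒o≢m (7 + 2 * m) 1 (lem m) e
    where lem : ∀ m → 7 + 2 * m + 2 ≡ 9 + 2 * m
          lem = solve-∀
  no-tail-after-extA-source (tailₙ _ e) = m+1+n≡o⇒o≢m (8 + 2 * m) 0 (lem m) e
    where lem : ∀ m → 8 + 2 * m + 1 ≡ 9 + 2 * m
          lem = solve-∀
  no-tail-after-extA-source (tailA i _ _ e) = 3*m≢r+3*n (suc i) m (s≤s z≤n) ≤-refl (+-cancelˡ-≡ (9 + 2 * m) _ _ (trans e (lem m)))
    where lem : ∀ m → 11 + 5 * m ≡ 9 + 2 * m + (2 + 3 * m)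
          lem = solve-∀
  no-tail-after-extA-source (tailB i _ _ e) = 3*m≢r+3*n (suc i) 0 (s≤s z≤n) ≤-refl (+-cancelˡ-≡ (7 + 2 * m) _ _ (trans (sym e) (lem m)))
    where lem : ∀ m → 9 + 2 * m ≡ 7 + 2 * m + (2 + 3 * 0)
          lem = solve-∀

  no-tail-after-chordA-source : ∀ {l} i → Tail l (9 + 2 * m + 3 * suc i) → ⊥
  no-tail-after-chordA-source i (tail₁ _ e) = 3*m≢r+3*n (suc i) m (s≤s z≤n) (s≤s (s≤s z≤n)) (+-cancelˡ-≡ (9 + 2 * m) _ _ (trans e (lem m)))
    where lem : ∀ m → 10 + 5 * m ≡ 9 + 2 * m + (1 + 3 * m)
          lem = solve-∀
  no-tail-after-chordA-source i (tailₙ₋₁ _ e) = m+1+n≡o⇒o≢m (7 + 2 * m) (1 + 3 * suc i) (lem m i) e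
    where lem : ∀ m i → 7 + 2 * m + suc (1 + 3 * suc i) ≡ 9 + 2 * m + 3 * suc i
          lem = solve-∀
  no-tail-after-chordA-source i (tailₙ _ e) = m+1+n≡o⇒o≢m (8 + 2 * m) (3 * suc i) (lem m i) e
    where lem : ∀ m i → 8 + 2 * m + suc (3 * suc i) ≡ 9 + 2 * m + 3 * suc i
          lem = solve-∀
  no-tail-after-chordA-source i (tailA j _ _ e) = 3*m≢r+3*n (suc i + suc j) m (s≤s z≤n) ≤-refl (+-cancelˡ-≡ (9 + 2 * m) _ _ (trans (lem1 m i j) (trans e (lem m))))
    where lem : ∀ m → 11 + 5 * m ≡ 9 + 2 * m + (2 + 3 * m)
          lem = solve-∀
          lem1 : ∀ m i j → 9 + 2 * m + 3 * (suc i + suc j) ≡ 9 + 2 * m + 3 * suc i + 3 * suc j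
          lem1 = solve-∀
  no-tail-after-chordA-source i (tailB j _ _ e) = 3*m≢r+3*n (suc j) (suc i) (s≤s z≤n) ≤-refl (+-cancelˡ-≡ (7 + 2 * m) _ _ (trans (sym e) (lem m i)))
    where lem : ∀ m i → 9 + 2 * m + 3 * suc i ≡ 7 + 2 * m + (2 + 3 * suc i)
          lem = solve-∀

  no-tail-before-M : ∀ {l} → Tail l (9 + 5 * m) → ⊥
  no-tail-before-M (tail₁ _ e) = m+1+n≡o⇒o≢m (9 + 5 * m) 0 (lem m) (sym e)
    where lem : ∀ m → 9 + 5 * m + 1 ≡ 10 + 5 * m
          lem = solve-∀
  no-tail-before-M (tailₙ₋₁ _ e) = m+1+n≡o⇒o≢m (7 + 2 * m) (1 + 3 * m) (lem m) e
    where lem : ∀ m → 7 + 2 * m + suc (1 + 3 * m) ≡ 9 + 5 * m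
          lem = solve-∀
  no-tail-before-M (tailₙ _ e) = m+1+n≡o⇒o≢m (8 + 2 * m) (3 * m) (lem m) e
    where lem : ∀ m → 8 + 2 * m + suc (3 * m) ≡ 9 + 5 * m
          lem = solve-∀
  no-tail-before-M (tailA i _ _ e) = 3*m≢r+3*n (suc i) 0 (s≤s z≤n) ≤-refl (+-cancelˡ-≡ (9 + 5 * m) _ _ (trans e (lem m)))
    where lem : ∀ m → 11 + 5 * m ≡ 9 + 5 * m + (2 + 3 * 0)
          lem = solve-∀
  no-tail-before-M (tailB i _ _ e) = 3*m≢r+3*n (suc i) m (s≤s z≤n) ≤-refl (+-cancelˡ-≡ (7 + 2 * m) _ _ (trans (sym e) (lem m)))
    where lem : ∀ m → 9 + 5 * m ≡ 7 + 2 * m + (2 + 3 * m)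
          lem = solve-∀

  no-tail-before-chordB-source : ∀ {l} c i → 8 + 2 * m ≤ c → suc c + 3 * suc i ≡ 10 + 5 * m → Tail l c → ⊥
  no-tail-before-chordB-source c i _ e (tail₁ _ refl) = m+1+n≡o⇒o≢m (10 + 5 * m) (3 * suc i) (lem m i) e
    where lem : ∀ m i → 10 + 5 * m + suc (3 * suc i) ≡ suc (10 + 5 * m) + 3 * suc i
          lem = solve-∀
  no-tail-before-chordB-source c i w e (tail₂ _ refl) = ≤⇒≯ (s≤s (z≤n {6 + 2 * m})) w
  no-tail-before-chordB-source c i w e (tailₙ₋₁ _ refl) = ≤⇒≯ ≤-refl w
  no-tail-before-chordB-source c i _ e (tailₙ _ refl) = 3*m≢r+3*n (suc i) m (s≤s z≤n) (s≤s (s≤s z≤n)) (+-cancelˡ-≡ (9 + 2 * m) _ _ (trans e (lem m)))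
    where lem : ∀ m → 10 + 5 * m ≡ 9 + 2 * m + (1 + 3 * m)
          lem = solve-∀
  no-tail-before-chordB-source c i _ e (tailA j _ _ e2) =
    3*m≢r+3*n (suc j) (suc i) (s≤s z≤n) ≤-refl (+-cancelˡ-≡ c _ _ (trans e2 (trans (lem m) (trans (cong suc (sym e)) (lem2 c i)))))
    where lem : ∀ m → 11 + 5 * m ≡ suc (10 + 5 * m)
          lem = solve-∀
          lem2 : ∀ c i → suc (suc c + 3 * suc i) ≡ c + (2 + 3 * suc i)
          lem2 = solve-∀
  no-tail-before-chordB-source c i _ e (tailB j _ _ refl) = 3*m≢r+3*n (suc j + suc i) m (s≤s z≤n) ≤-refl (+-cancelˡ-≡ (8 + 2 * m) _ _ (trans (lem m i j) (trans e (lem2 m))))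
    where lem : ∀ m i j → 8 + 2 * m + 3 * (suc j + suc i) ≡ suc (7 + 2 * m + 3 * suc j) + 3 * suc i
          lem = solve-∀
          lem2 : ∀ m → 10 + 5 * m ≡ 8 + 2 * m + (2 + 3 * m)
          lem2 = solve-∀

  chord-from-M : ∀ {y} → Chord (10 + 5 * m) y → y ≡ 2
  chord-from-M (isExtA e _) = ⊥-elim (m+1+n≡o⇒o≢m (8 + 2 * m) (1 + 3 * m) (lem m) e)
    where lem : ∀ m → 8 + 2 * m + suc (1 + 3 * m) ≡ 10 + 5 * m
          lem = solve-∀
  chord-from-M (isExtB _ e) = e
  chord-from-M (isChordA i _ e _) = ⊥-elim (3*m≢r+3*n (suc i) m (s≤s z≤n) ≤-refl (+-cancelˡ-≡ (8 + 2 * m) _ _ (trans (sym e) (lem m))))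
    where lem : ∀ m → 10 + 5 * m ≡ 8 + 2 * m + (2 + 3 * m)
          lem = solve-∀
  chord-from-M (isChordB i _ e _) = ⊥-elim (m+1+n≡o⇒o≢m (10 + 5 * m) (2 + 3 * i) (lem m i) e)
    where lem : ∀ m i → 10 + 5 * m + suc (2 + 3 * i) ≡ 10 + 5 * m + 3 * suc i
          lem = solve-∀

  chord-from-8+2m : ∀ {y} → Chord (8 + 2 * m) y → y ≡ 6 + 2 * m
  chord-from-8+2m (isExtA _ e) = e
  chord-from-8+2m (isExtB e _) = ⊥-elim (m+1+n≡o⇒o≢m (8 + 2 * m) (1 + 3 * m) (lem m) (sym e))
    where lem : ∀ m → 8 + 2 * m + suc (1 + 3 * m) ≡ 10 + 5 * m
          lem = solve-∀
  chord-from-8+2m (isChordA i _ e _) = ⊥-elim (m+1+n≡o⇒o≢m (8 + 2 * m) (2 + 3 * i) (lem m i) (sym e))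
    where lem : ∀ m i → 8 + 2 * m + suc (2 + 3 * i) ≡ 8 + 2 * m + 3 * suc i
          lem = solve-∀
  chord-from-8+2m (isChordB i _ e _) = ⊥-elim (3*m≢r+3*n (suc i) m (s≤s z≤n) ≤-refl (+-cancelˡ-≡ (8 + 2 * m) _ _ (trans e (lem m))))
    where lem : ∀ m → 10 + 5 * m ≡ 8 + 2 * m + (2 + 3 * m)
          lem = solve-∀

  tail-at-M : ∀ {l'} → Tail l' (10 + 5 * m) → l' ≡ 0
  tail-at-M (tail₁ e _) = e
  tail-at-M (tail₂ _ ())
  tail-at-M (tailₙ₋₁ _ e) = ⊥-elim (m+1+n≡o⇒o≢m (7 + 2 * m) (2 + 3 * m) (lem m) e)
    where lem : ∀ m → 7 + 2 * m + suc (2 + 3 * m) ≡ 10 + 5 * m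
          lem = solve-∀
  tail-at-M (tailₙ _ e) = ⊥-elim (m+1+n≡o⇒o≢m (8 + 2 * m) (1 + 3 * m) (lem m) e)
    where lem : ∀ m → 8 + 2 * m + suc (1 + 3 * m) ≡ 10 + 5 * m
          lem = solve-∀
  tail-at-M (tailA i _ _ e) = ⊥-elim (3*m≢r+3*n (suc i) 0 (s≤s z≤n) (s≤s (s≤s z≤n)) (+-cancelˡ-≡ (10 + 5 * m) _ _ (trans e (lem m))))
    where lem : ∀ m → 11 + 5 * m ≡ 10 + 5 * m + (1 + 3 * 0)
          lem = solve-∀
  tail-at-M (tailB i i≤ _ e) = ⊥-elim (1+n≰n (≤-trans (≤-reflexive (*-cancelˡ-≡ _ _ 3 (+-cancelˡ-≡ (7 + 2 * m) _ _ (trans (lem m) e)))) (≤-trans i≤ chordsA≤m)))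
    where lem : ∀ m → 7 + 2 * m + 3 * (1 + m) ≡ 10 + 5 * m
          lem = solve-∀

  tail-at-1 : ∀ {l'} → Tail l' 1 → l' ≡ 1
  tail-at-1 (tail₁ _ ())
  tail-at-1 (tail₂ e _) = e
  tail-at-1 (tailₙ₋₁ _ ())
  tail-at-1 (tailₙ _ ())
  tail-at-1 (tailA i i≤ _ e) = ⊥-elim (<⇒≱ (s≤s (s≤s z≤n)) (tailA-source≥11+2m e i≤))
  tail-at-1 (tailB _ _ _ ())

  tail-at-1+chordB-source : ∀ {l'} i → suc i ≤ chordsB → ∀ c → c + 3 * suc i ≡ 10 + 5 * m → Tail l' (suc c) → l' ≡ suc (suc i)
  tail-at-1+chordB-source i i≤ c ce (tail₁ _ e) = ⊥-elim (3*m≢r+3*n (suc i) 0 (s≤s z≤n) (s≤s (s≤s z≤n)) (+-cancelˡ-≡ c _ _ (trans ce (trans (sym e) (+-comm 1 c)))))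
  tail-at-1+chordB-source i i≤ c ce (tail₂ _ e) = ⊥-elim (≤⇒≯ (≤-reflexive (suc-injective e)) (≤-trans (s≤s z≤n) (chordB-source≥10+2m ce i≤)))
  tail-at-1+chordB-source i i≤ c ce (tailₙ₋₁ _ e) = ⊥-elim (≤⇒≯ (≤-reflexive (suc-injective e)) (≤-trans (m≤n+m _ 3) (chordB-source≥10+2m ce i≤)))
  tail-at-1+chordB-source i i≤ c ce (tailₙ _ e) = ⊥-elim (≤⇒≯ (≤-reflexive (suc-injective e)) (≤-trans (m≤n+m _ 2) (chordB-source≥10+2m ce i≤)))
  tail-at-1+chordB-source i i≤ c ce (tailA j _ le e2) =
    trans le (cong (λ z → suc (suc z)) (suc-injective (*-cancelˡ-≡ _ _ 3 (+-cancelˡ-≡ c _ _ (suc-injective (trans e2 (cong suc (sym ce))))))))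
  tail-at-1+chordB-source i i≤ c ce (tailB j _ _ e2) =
    ⊥-elim (3*m≢r+3*n (suc j + suc i) (1 + m) (s≤s z≤n) (s≤s (s≤s z≤n))
      (+-cancelˡ-≡ (7 + 2 * m) _ _ (trans (lem m i j) (trans (cong (_+ 3 * suc i) (sym e2)) (trans (cong suc ce) (lem2 m))))))
    where lem : ∀ m i j → 7 + 2 * m + 3 * (suc j + suc i) ≡ 7 + 2 * m + 3 * suc j + 3 * suc i
          lem = solve-∀
          lem2 : ∀ m → suc (10 + 5 * m) ≡ 7 + 2 * m + (1 + 3 * (1 + m))
          lem2 = solve-∀

  tail-at-7+2m+3i : ∀ {l'} l i' → l + i' ≡ 2 + m → i' ≤ chordsA → Tail l' (7 + 2 * m + 3 * i') → l' ≡ l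
  tail-at-7+2m+3i l i' li i'≤ (tail₁ _ e) =
    ⊥-elim (1+n≰n (≤-trans (≤-reflexive (*-cancelˡ-≡ _ _ 3 (+-cancelˡ-≡ (7 + 2 * m) _ _ (trans (lem m) (sym e))))) (≤-trans i'≤ chordsA≤m)))
    where lem : ∀ m → 7 + 2 * m + 3 * (1 + m) ≡ 10 + 5 * m
          lem = solve-∀
  tail-at-7+2m+3i l i' li i'≤ (tail₂ _ ())
  tail-at-7+2m+3i l i' li i'≤ (tailₙ₋₁ le e) = trans le (trans (sym li) (trans (cong (l +_) i'0) (+-identityʳ l)))
    where i'0 : i' ≡ 0
          i'0 = *-cancelˡ-≡ _ _ 3 (+-cancelˡ-≡ (7 + 2 * m) _ _ (trans e (sym (+-identityʳ _))))
  tail-at-7+2m+3i l i' li i'≤ (tailₙ _ e) = ⊥-elim (3*m≢r+3*n i' 0 (s≤s z≤n) (s≤s (s≤s z≤n)) (+-cancelˡ-≡ (7 + 2 * m) _ _ (trans e (lem m))))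
    where lem : ∀ m → 8 + 2 * m ≡ 7 + 2 * m + (1 + 3 * 0)
          lem = solve-∀
  tail-at-7+2m+3i l i' li i'≤ (tailA j _ _ e) =
    ⊥-elim (3*m≢r+3*n (i' + suc j) (1 + m) (s≤s z≤n) (s≤s (s≤s z≤n)) (+-cancelˡ-≡ (7 + 2 * m) _ _ (trans (lem m i' j) (trans e (lem2 m)))))
    where lem : ∀ m i j → 7 + 2 * m + 3 * (i + suc j) ≡ 7 + 2 * m + 3 * i + 3 * suc j
          lem = solve-∀
          lem2 : ∀ m → 11 + 5 * m ≡ 7 + 2 * m + (1 + 3 * (1 + m))
          lem2 = solve-∀
  tail-at-7+2m+3i l i' li i'≤ (tailB j _ le e) = +-cancelʳ-≡ (suc j) _ _ (trans le (trans (sym li) (cong (l +_) i'j)))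
    where i'j : i' ≡ suc j
          i'j = *-cancelˡ-≡ _ _ 3 (+-cancelˡ-≡ (7 + 2 * m) _ _ e)

  tail-at-8+2m : ∀ {l'} → Tail l' (8 + 2 * m) → l' ≡ 3 + m
  tail-at-8+2m (tail₁ _ e) = ⊥-elim (m+1+n≡o⇒o≢m (8 + 2 * m) (1 + 3 * m) (lem m) (sym e))
    where lem : ∀ m → 8 + 2 * m + suc (1 + 3 * m) ≡ 10 + 5 * m
          lem = solve-∀
  tail-at-8+2m (tail₂ _ ())
  tail-at-8+2m (tailₙ₋₁ _ e) = ⊥-elim (1+n≰n (≤-reflexive e))
  tail-at-8+2m (tailₙ le _) = le
  tail-at-8+2m (tailA j j≤ _ e) =
    ⊥-elim (1+n≰n (≤-trans (≤-reflexive (sym (*-cancelˡ-≡ _ _ 3 (+-cancelˡ-≡ (8 + 2 * m) _ _ (trans e (lem m)))))) (≤-trans j≤ chordsB≤m)))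
    where lem : ∀ m → 11 + 5 * m ≡ 8 + 2 * m + 3 * (1 + m)
          lem = solve-∀
  tail-at-8+2m (tailB j _ _ e) = ⊥-elim (3*m≢r+3*n (suc j) 0 (s≤s z≤n) (s≤s (s≤s z≤n)) (sym (+-cancelˡ-≡ (7 + 2 * m) _ _ (trans (lem m) e))))
    where lem : ∀ m → 7 + 2 * m + (1 + 3 * 0) ≡ 8 + 2 * m
          lem = solve-∀

record IsHamSuccessor (m : ℕ) (f : ℕ → ℕ) : Set where
  field
    f-arc       : ∀ x → x ≤ 10 + 5 * m → Normalised.Arc m x (f x)
    f-bounded   : ∀ x → x ≤ 10 + 5 * m → f x ≤ 10 + 5 * m
    f-injective : ∀ x y → x ≤ 10 + 5 * m → y ≤ 10 + 5 * m → f x ≡ f y → x ≡ y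
    f-orbit     : ∀ x y → x ≤ 10 + 5 * m → y ≤ 10 + 5 * m → ∃ λ k → iter f k x ≡ y

module HamSuccessor (m : ℕ) (f : ℕ → ℕ) (hs : IsHamSuccessor m f) where
  open IsHamSuccessor hs public
  open Normalised m
  open ArcShapes m
  open TailPositions m

  iter-bounded : ∀ k x → x ≤ M → iter f k x ≤ M
  iter-bounded zero x h = h
  iter-bounded (suc k) x h = f-bounded _ (iter-bounded k x h)

  f-closed⇒universal : (Q : ℕ → Set) → (∀ x → x ≤ M → Q x → Q (f x)) → ∀ {x y} → x ≤ M → y ≤ M → Q x → Q y
  f-closed⇒universal Q cl {x} {y} hx hy q with f-orbit x y hx hy
  ... | k , refl = go k
    where go : ∀ k → Q (iter f k x)
          go zero = q
          go (suc k) = cl _ (iter-bounded k x hx) (go k)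

  f-closed⇒¬excludes : (Q : ℕ → Set) → (∀ x → x ≤ M → Q x → Q (f x)) → ∀ {x y} → x ≤ M → y ≤ M → Q x → ¬ Q y → ⊥
  f-closed⇒¬excludes Q cl hx hy q nq = nq (f-closed⇒universal Q cl hx hy q)

  0≤M : 0 ≤ M
  0≤M = z≤n
  1≤M : 1 ≤ M
  1≤M = s≤s z≤n
  2≤M : 2 ≤ M
  2≤M = s≤s (s≤s z≤n)

  preimage : ∀ y → y ≤ M → ∃ λ x → x ≤ M × f x ≡ y
  preimage y hy with f-orbit (f y) y (f-bounded y hy) hy
  ... | suc k , e = iter f k (f y) , iter-bounded k (f y) (f-bounded y hy) , e
  ... | zero , e with y
  ...   | zero = ⊥-elim (f-closed⇒¬excludes (_≡ 0) (λ { x _ refl → e }) 0≤M 1≤M refl (λ ()))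
  ...   | suc y' = ⊥-elim (f-closed⇒¬excludes (_≡ suc y') (λ { x _ refl → e }) hy 0≤M refl (λ ()))

  -- {x, y} would be closed under f, but some vertex ≤ 2 lies outside it.
  no-2-cycle : ∀ {x y} → x ≤ M → y ≤ M → f x ≡ y → f y ≡ x → ⊥
  no-2-cycle {x} {y} hx hy e1 e2 = go third
    where
    Q : ℕ → Set
    Q z = z ≡ x ⊎ z ≡ y
    cl : ∀ z → z ≤ M → Q z → Q (f z)
    cl z _ (inj₁ refl) = inj₂ e1
    cl z _ (inj₂ refl) = inj₁ e2
    third : ∃ λ z → z ≤ 2 × z ≢ x × z ≢ y
    third with x ≟ 0 | y ≟ 0 | x ≟ 1 | y ≟ 1
    ... | no a | no b | _ | _ = 0 , z≤n , (λ e → a (sym e)) , (λ e → b (sym e))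
    ... | yes refl | _ | _ | no b = 1 , s≤s z≤n , (λ ()) , (λ e → b (sym e))
    ... | yes refl | _ | _ | yes refl = 2 , ≤-refl , (λ ()) , (λ ())
    ... | no a | yes refl | no c | _ = 1 , s≤s z≤n , (λ e → c (sym e)) , (λ ())
    ... | no a | yes refl | yes refl | _ = 2 , ≤-refl , (λ ()) , (λ ())
    go : (∃ λ z → z ≤ 2 × z ≢ x × z ≢ y) → ⊥
    go (z , z≤ , a , b) = f-closed⇒¬excludes Q cl hx (≤-trans z≤ 2≤M) (inj₁ refl) (λ { (inj₁ e) → a e ; (inj₂ e) → b e })

  same-image⇒≡ : ∀ {x y z} → x ≤ M → y ≤ M → f x ≡ z → f y ≡ z → x ≡ y
  same-image⇒≡ hx hy e1 e2 = f-injective _ _ hx hy (trans e1 (sym e2))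

  low-step : ∀ w → 2 ≤ w → w ≤ 6 + 2 * m → suc (f w) ≡ w ⊎ f w ≡ suc w
  low-step w h1 h2 with arc-from-low (≤-trans (s≤s z≤n) h1) (≤-trans h2 (n≤1+n _)) (f-arc w (≤-trans (≤-trans h2 (n≤1+n _)) (≤-trans (n≤1+n _) 8+2m≤M)))
  ... | inj₁ e = inj₁ e
  ... | inj₂ (inj₁ e) = inj₂ e
  ... | inj₂ (inj₂ (inj₁ (refl , _))) with h1
  ...   | s≤s ()
  low-step w h1 h2 | inj₂ (inj₂ (inj₂ (_ , inj₁ refl))) with h1
  ...   | s≤s ()
  low-step w h1 h2 | inj₂ (inj₂ (inj₂ (_ , inj₂ refl))) = ⊥-elim (1+n≰n h2)

  low≤M : ∀ {x} → x ≤ 7 + 2 * m → x ≤ M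
  low≤M h = ≤-trans h (≤-trans (n≤1+n _) 8+2m≤M)

  rightward-run : ∀ x d → 1 ≤ x → f x ≡ suc x → x + d ≤ 6 + 2 * m → f (x + d) ≡ suc (x + d)
  rightward-run x zero h e _ = subst (λ z → f z ≡ suc z) (sym (+-identityʳ x)) e
  rightward-run x (suc d) h e h2 = subst (λ z → f z ≡ suc z) (sym (+-suc x d)) (go (low-step (suc (x + d)) (s≤s (≤-trans h (m≤m+n x d))) h2'))
    where
    h2' : suc (x + d) ≤ 6 + 2 * m
    h2' = subst (_≤ 6 + 2 * m) (+-suc x d) h2
    ih : f (x + d) ≡ suc (x + d)
    ih = rightward-run x d h e (≤-trans (n≤1+n _) h2')
    go : suc (f (suc (x + d))) ≡ suc (x + d) ⊎ f (suc (x + d)) ≡ suc (suc (x + d)) → f (suc (x + d)) ≡ suc (suc (x + d))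
    go (inj₂ e2) = e2
    go (inj₁ e2) = ⊥-elim (no-2-cycle (low≤M (≤-trans (n≤1+n _) (≤-trans h2' (n≤1+n _)))) (low≤M (≤-trans h2' (n≤1+n _))) ih (suc-injective e2))

  rightward : ∀ a → 1 ≤ a → f a ≡ suc a → ∀ x → a ≤ x → x ≤ 6 + 2 * m → f x ≡ suc x
  rightward a h e x a≤x x≤ = subst (λ z → f z ≡ suc z) (m+[n∸m]≡n a≤x) (rightward-run a (x ∸ a) h e (subst (_≤ 6 + 2 * m) (sym (m+[n∸m]≡n a≤x)) x≤))

  leftward-run : ∀ y d → 1 ≤ y → f (suc (d + y)) ≡ d + y → d + y ≤ 6 + 2 * m → f (suc y) ≡ y
  leftward-run y zero h e _ = e
  leftward-run y (suc d) h e h2 with low-step (suc (d + y)) (s≤s (≤-trans h (m≤n+m y d))) h2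
  ... | inj₁ e2 = leftward-run y d h (suc-injective e2) (≤-trans (n≤1+n _) h2)
  ... | inj₂ e2 = ⊥-elim (no-2-cycle (low≤M (≤-trans h2 (n≤1+n _))) (low≤M (s≤s h2)) e2 e)

  leftward : ∀ t → f (suc t) ≡ t → t ≤ 6 + 2 * m → ∀ y → 1 ≤ y → suc y ≤ suc t → f (suc y) ≡ y
  leftward t e t≤ y h (s≤s y≤t) = leftward-run y (t ∸ y) h (subst (λ z → f (suc z) ≡ z) (sym (m∸n+n≡m y≤t)) e) (subst (_≤ 6 + 2 * m) (sym (m∸n+n≡m y≤t)) t≤)

  f1-cases : f 2 ≡ 1 → f 1 ≡ M ⊎ f 1 ≡ 0
  f1-cases e2 with arc-from-low (s≤s z≤n) (s≤s z≤n) (f-arc 1 1≤M)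
  ... | inj₁ e = inj₂ (suc-injective e)
  ... | inj₂ (inj₁ e) = ⊥-elim (no-2-cycle 1≤M 2≤M e e2)
  ... | inj₂ (inj₂ (inj₁ (_ , e))) = inj₁ e
  ... | inj₂ (inj₂ (inj₂ (e , _))) = inj₂ e

  7+2m≤M : 7 + 2 * m ≤ M
  7+2m≤M = low≤M ≤-refl

  f[7+2m]-cases : f (6 + 2 * m) ≡ 7 + 2 * m → f (7 + 2 * m) ≡ 8 + 2 * m ⊎ f (7 + 2 * m) ≡ 0
  f[7+2m]-cases e with arc-from-low (s≤s z≤n) ≤-refl (f-arc (7 + 2 * m) 7+2m≤M)
  ... | inj₁ e′ = ⊥-elim (no-2-cycle (low≤M (n≤1+n _)) 7+2m≤M e (suc-injective e′))
  ... | inj₂ (inj₁ e′) = inj₁ e′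
  ... | inj₂ (inj₂ (inj₁ (() , _)))
  ... | inj₂ (inj₂ (inj₂ (e′ , _))) = inj₂ e′

  -- How the cycle traverses the low vertices: it enters from v at f 0 = 1 + 2 label, the low
  -- vertices 2 .. split are walked leftwards and split+1 .. 6+2m rightwards, and the one even
  -- vertex gap next to f 0 (not reached along the low path) must be entered by a chord.
  record LowSplit : Set where
    field
      label split gap : ℕ
      label≤    : label ≤ 3 + m
      f0≡       : f 0 ≡ 1 + 2 * label
      split≤    : split ≤ 7 + 2 * m
      goesLeft  : ∀ y → 1 ≤ y → suc y ≤ split → f (suc y) ≡ y
      goesRight : ∀ x → split < x → x ≤ 6 + 2 * m → f x ≡ suc x
      entry     : (f 0 ≡ suc split × gap ≡ split) ⊎ (f 0 ≡ split × gap ≡ suc split)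
      gap-even  : ∃ λ q → gap ≡ 2 * q
      at1       : (1 ≤ split × (f 1 ≡ M ⊎ f 1 ≡ 0)) ⊎ (split ≡ 0 × f 1 ≡ 2)
      at7+2m    : (split ≤ 6 + 2 * m × (f (7 + 2 * m) ≡ 8 + 2 * m ⊎ f (7 + 2 * m) ≡ 0))
                ⊎ (split ≡ 7 + 2 * m × f (7 + 2 * m) ≡ 6 + 2 * m)

  open LowSplit

  1+2[3+m]≡7+2m : 1 + 2 * (3 + m) ≡ 7 + 2 * m
  1+2[3+m]≡7+2m = cong suc (*-distribˡ-+ 2 3 m)

  8+2m≡2[4+m] : 8 + 2 * m ≡ 2 * (4 + m)
  8+2m≡2[4+m] = sym (*-distribˡ-+ 2 4 m)

  6+2m≡2[3+m] : 6 + 2 * m ≡ 2 * (3 + m)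
  6+2m≡2[3+m] = sym (*-distribˡ-+ 2 3 m)

  6+2m≤M : 6 + 2 * m ≤ M
  6+2m≤M = low≤M (n≤1+n _)

  lowSplit-label0 : f 0 ≡ 1 → LowSplit
  lowSplit-label0 e0 with arc-from-low (s≤s z≤n) (s≤s z≤n) (f-arc 1 1≤M)
  ... | inj₁ e = ⊥-elim (no-2-cycle 0≤M 1≤M e0 (suc-injective e))
  ... | inj₂ (inj₂ (inj₂ (e , _))) = ⊥-elim (no-2-cycle 0≤M 1≤M e0 e)
  ... | inj₂ (inj₁ e) = record { label = 0 ; split = 0 ; gap = 0 ; label≤ = z≤n ; f0≡ = e0 ; split≤ = z≤n
        ; goesLeft = λ y h1 h2 → ⊥-elim (<⇒≱ (s≤s z≤n) h2)
        ; goesRight = rt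
        ; entry = inj₁ (e0 , refl) ; gap-even = 0 , refl ; at1 = inj₂ (refl , e)
        ; at7+2m = inj₁ (z≤n , f[7+2m]-cases (rt (6 + 2 * m) (s≤s z≤n) ≤-refl)) }
    where rt : ∀ x → 0 < x → x ≤ 6 + 2 * m → f x ≡ suc x
          rt x h1 h2 = rightward 1 (s≤s z≤n) e x h1 h2
  ... | inj₂ (inj₂ (inj₁ (_ , eM))) = record { label = 0 ; split = 1 ; gap = 2 ; label≤ = z≤n ; f0≡ = e0 ; split≤ = s≤s z≤n
        ; goesLeft = λ { y (s≤s z≤n) (s≤s ()) }
        ; goesRight = rt
        ; entry = inj₂ (e0 , refl) ; gap-even = 1 , refl ; at1 = inj₁ (s≤s z≤n , inj₁ eM)
        ; at7+2m = inj₁ (s≤s z≤n , f[7+2m]-cases (rt (6 + 2 * m) (s≤s (s≤s z≤n)) ≤-refl)) }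
    where
    f2 : f 2 ≡ 3
    f2 with low-step 2 (s≤s (s≤s z≤n)) (s≤s (s≤s z≤n))
    ... | inj₁ e = ⊥-elim (1+n≢0 (same-image⇒≡ 2≤M 0≤M (suc-injective e) e0))
    ... | inj₂ e = e
    rt : ∀ x → 1 < x → x ≤ 6 + 2 * m → f x ≡ suc x
    rt x h1 h2 = rightward 2 (s≤s z≤n) f2 x h1 h2

  lowSplit-lastLabel : f 0 ≡ 7 + 2 * m → LowSplit
  lowSplit-lastLabel e0 with arc-from-low (s≤s z≤n) ≤-refl (f-arc (7 + 2 * m) 7+2m≤M)
  ... | inj₂ (inj₂ (inj₁ (() , _)))
  ... | inj₂ (inj₂ (inj₂ (e , _))) = ⊥-elim (no-2-cycle 0≤M 7+2m≤M e0 e)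
  ... | inj₁ e = record { label = 3 + m ; split = 7 + 2 * m ; gap = 8 + 2 * m ; label≤ = ≤-refl ; f0≡ = trans e0 (sym 1+2[3+m]≡7+2m) ; split≤ = ≤-refl
        ; goesLeft = lt
        ; goesRight = λ x h1 h2 → ⊥-elim (<⇒≱ h1 (≤-trans h2 (n≤1+n _)))
        ; entry = inj₂ (e0 , refl) ; gap-even = 4 + m , 8+2m≡2[4+m]
        ; at1 = inj₁ (s≤s z≤n , f1-cases (lt 1 (s≤s z≤n) (s≤s (s≤s z≤n))))
        ; at7+2m = inj₂ (refl , suc-injective e) }
    where lt : ∀ y → 1 ≤ y → suc y ≤ 7 + 2 * m → f (suc y) ≡ y
          lt = leftward (6 + 2 * m) (suc-injective e) ≤-refl
  ... | inj₂ (inj₁ e) = record { label = 3 + m ; split = 6 + 2 * m ; gap = 6 + 2 * m ; label≤ = ≤-refl ; f0≡ = trans e0 (sym 1+2[3+m]≡7+2m) ; split≤ = n≤1+n _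
        ; goesLeft = lt
        ; goesRight = λ x h1 h2 → ⊥-elim (<⇒≱ h1 h2)
        ; entry = inj₁ (e0 , refl) ; gap-even = 3 + m , 6+2m≡2[3+m]
        ; at1 = inj₁ (s≤s z≤n , f1-cases (lt 1 (s≤s z≤n) (s≤s (s≤s z≤n))))
        ; at7+2m = inj₁ (≤-refl , inj₁ e) }
    where
    f6 : f (6 + 2 * m) ≡ 5 + 2 * m
    f6 with low-step (6 + 2 * m) (s≤s (s≤s z≤n)) ≤-refl
    ... | inj₁ e2 = suc-injective e2
    ... | inj₂ e2 = ⊥-elim (1+n≢0 (same-image⇒≡ 6+2m≤M 0≤M e2 e0))
    lt : ∀ y → 1 ≤ y → suc y ≤ 6 + 2 * m → f (suc y) ≡ y
    lt = leftward (5 + 2 * m) f6 (n≤1+n _)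

  lowSplit-middleLabel : ∀ l' → suc l' ≤ 2 + m → f 0 ≡ 1 + 2 * suc l' → LowSplit
  lowSplit-middleLabel l' l≤ e0 = go (low-step (1 + 2 * suc l') (s≤s (s≤s z≤n)) (≤-trans hb (n≤1+n _)))
    where
    hb : 1 + 2 * suc l' ≤ 5 + 2 * m
    hb = ≤-trans (+-monoʳ-≤ 1 (*-monoʳ-≤ 2 l≤)) (≤-reflexive (lem m))
      where lem : ∀ m → 1 + 2 * (2 + m) ≡ 5 + 2 * m
            lem = solve-∀
    w≤ : 2 * suc l' ≤ 6 + 2 * m
    w≤ = ≤-trans (n≤1+n _) (≤-trans hb (n≤1+n _))
    go : suc (f (1 + 2 * suc l')) ≡ 1 + 2 * suc l' ⊎ f (1 + 2 * suc l') ≡ suc (1 + 2 * suc l') → LowSplit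
    go (inj₁ e) = record { label = suc l' ; split = 1 + 2 * suc l' ; gap = 2 + 2 * suc l' ; label≤ = m≤n⇒m≤1+n l≤ ; f0≡ = e0
        ; split≤ = ≤-trans hb (≤-trans (n≤1+n _) (n≤1+n _))
        ; goesLeft = lt ; goesRight = rt
        ; entry = inj₂ (e0 , refl) ; gap-even = suc (suc l') , lem l'
        ; at1 = inj₁ (s≤s z≤n , f1-cases (lt 1 (s≤s z≤n) (s≤s (s≤s z≤n))))
        ; at7+2m = inj₁ (≤-trans hb (n≤1+n _) , f[7+2m]-cases (rt (6 + 2 * m) (s≤s hb) ≤-refl)) }
      where
      lem : ∀ l → 2 + 2 * suc l ≡ 2 * suc (suc l)
      lem = solve-∀
      lt : ∀ y → 1 ≤ y → suc y ≤ 1 + 2 * suc l' → f (suc y) ≡ y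
      lt = leftward (2 * suc l') (suc-injective e) w≤
      f2 : f (2 + 2 * suc l') ≡ 3 + 2 * suc l'
      f2 with low-step (2 + 2 * suc l') (s≤s (s≤s z≤n)) (s≤s hb)
      ... | inj₁ e2 = ⊥-elim (1+n≢0 (same-image⇒≡ (low≤M (s≤s (≤-trans hb (n≤1+n _)))) 0≤M (suc-injective e2) e0))
      ... | inj₂ e2 = e2
      rt : ∀ x → 1 + 2 * suc l' < x → x ≤ 6 + 2 * m → f x ≡ suc x
      rt = rightward (2 + 2 * suc l') (s≤s z≤n) f2
    go (inj₂ e) = record { label = suc l' ; split = 2 * suc l' ; gap = 2 * suc l' ; label≤ = m≤n⇒m≤1+n l≤ ; f0≡ = e0
        ; split≤ = ≤-trans w≤ (n≤1+n _)
        ; goesLeft = lt ; goesRight = rt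
        ; entry = inj₁ (e0 , refl) ; gap-even = suc l' , refl
        ; at1 = inj₁ (s≤s z≤n , f1-cases (lt 1 (s≤s z≤n) 2≤w))
        ; at7+2m = inj₁ (w≤ , f[7+2m]-cases (rt (6 + 2 * m) (≤-trans hb (n≤1+n _)) ≤-refl)) }
      where
      lem : ∀ l → 2 * suc l ≡ suc (1 + 2 * l)
      lem = solve-∀
      fw : f (suc (1 + 2 * l')) ≡ 1 + 2 * l'
      2≤w : 2 ≤ 2 * suc l'
      2≤w = subst (2 ≤_) (sym (lem l')) (s≤s (s≤s z≤n))
      fw with low-step (2 * suc l') 2≤w w≤
      ... | inj₁ e2 = suc-injective (subst (λ z → suc (f z) ≡ z) (lem l') e2)
      ... | inj₂ e2 = ⊥-elim (1+n≢0 (same-image⇒≡ (low≤M (≤-trans w≤ (n≤1+n _))) 0≤M e2 e0))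
      lt : ∀ y → 1 ≤ y → suc y ≤ 2 * suc l' → f (suc y) ≡ y
      lt y h1 h2 = leftward (1 + 2 * l') fw (≤-trans (≤-trans (n≤1+n _) (≤-reflexive (sym (lem l')))) w≤) y h1 (subst (suc y ≤_) (lem l') h2)
      rt : ∀ x → 2 * suc l' < x → x ≤ 6 + 2 * m → f x ≡ suc x
      rt = rightward (1 + 2 * suc l') (s≤s z≤n) e

  lowSplit : LowSplit
  lowSplit with arc-from-v (f-arc 0 0≤M)
  ... | zero , _ , e0 = lowSplit-label0 e0
  ... | suc l' , l≤ , e0 with m≤n⇒m<n∨m≡n l≤
  ...   | inj₂ refl = lowSplit-lastLabel (trans e0 1+2[3+m]≡7+2m)
  ...   | inj₁ (s≤s l<) = lowSplit-middleLabel l' l< e0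

<⇒<ᵇ≡true : ∀ {x b} → x < b → (x <ᵇ b) ≡ true
<⇒<ᵇ≡true {x} {b} h with x <ᵇ b | <⇒<ᵇ h
... | true | _ = refl

≥⇒<ᵇ≡false : ∀ {x b} → b ≤ x → (x <ᵇ b) ≡ false
≥⇒<ᵇ≡false {x} {b} h with x <ᵇ b | <ᵇ⇒< x b
... | false | _ = refl
... | true | p = ⊥-elim (<⇒≱ (p tt) h)

module Candidates (m : ℕ) where
  open Normalised m

  -- For u = true:  v → s+1 → … → c → s → … → 1 → M → … → c+1 → v  (chord c → s);
  -- for u = false: v → s → … → 1 → M → … → c+1 → s+1 → … → c → v  (chord c+1 → s+1).
  chordCycle : Bool → ℕ → ℕ → ℕ → ℕ
  chordCycle u s c zero = if u then suc s else s
  chordCycle u s c (suc zero) = 10 + 5 * m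
  chordCycle u s c x@(suc (suc _)) =
    if x <ᵇ suc s then pred x else
    if x <ᵇ c then suc x else
    if x <ᵇ suc c then (if u then s else 0) else
    if x <ᵇ suc (suc c) then (if u then 0 else suc s) else pred x

  module _ (u : Bool) (s c : ℕ) where
    chordCycle-left : ∀ y → suc (suc y) ≤ s → chordCycle u s c (suc (suc y)) ≡ suc y
    chordCycle-left y h rewrite <⇒<ᵇ≡true {suc (suc y)} {suc s} (s≤s h) = refl

    chordCycle-middle : ∀ y → s < suc (suc y) → suc (suc y) < c → chordCycle u s c (suc (suc y)) ≡ suc (suc (suc y))
    chordCycle-middle y h1 h2 rewrite ≥⇒<ᵇ≡false {suc (suc y)} {suc s} h1 | <⇒<ᵇ≡true {suc (suc y)} {c} h2 = refl

    chordCycle-c : 2 ≤ c → s < c → chordCycle u s c c ≡ (if u then s else 0)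
    chordCycle-c (s≤s (s≤s {n = c'} _)) h rewrite ≥⇒<ᵇ≡false {suc (suc c')} {suc s} h | ≥⇒<ᵇ≡false {suc (suc c')} {suc (suc c')} ≤-refl
      | <⇒<ᵇ≡true {suc (suc c')} {suc (suc (suc c'))} ≤-refl = refl

    chordCycle-1+c : 1 ≤ c → s < c → chordCycle u s c (suc c) ≡ (if u then 0 else suc s)
    chordCycle-1+c (s≤s {n = c'} _) h rewrite ≥⇒<ᵇ≡false {suc (suc c')} {suc s} (m≤n⇒m≤1+n h) | ≥⇒<ᵇ≡false {suc (suc c')} {suc c'} (n≤1+n _)
      | ≥⇒<ᵇ≡false {suc (suc c')} {suc (suc c')} ≤-refl | <⇒<ᵇ≡true {suc (suc c')} {suc (suc (suc c'))} ≤-refl = refl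

    chordCycle-right : ∀ y → s < c → suc c ≤ y → chordCycle u s c (suc y) ≡ y
    chordCycle-right (suc y) h h2 rewrite ≥⇒<ᵇ≡false {suc (suc y)} {suc s} (≤-trans h (≤-trans (n≤1+n c) (m≤n⇒m≤1+n h2)))
      | ≥⇒<ᵇ≡false {suc (suc y)} {c} (≤-trans (n≤1+n c) (m≤n⇒m≤1+n h2))
      | ≥⇒<ᵇ≡false {suc (suc y)} {suc c} (m≤n⇒m≤1+n h2) | ≥⇒<ᵇ≡false {suc (suc y)} {suc (suc c)} (s≤s h2) = refl
    chordCycle-right zero h ()

    chordCycle-determined : (g : ℕ → ℕ) → (B : ℕ) → 1 ≤ s → s < c →
      g 0 ≡ (if u then suc s else s) → g 1 ≡ 10 + 5 * m →
      (∀ y → 1 ≤ y → suc y ≤ s → g (suc y) ≡ y) →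
      (∀ x → s < x → x < c → g x ≡ suc x) →
      g c ≡ (if u then s else 0) → g (suc c) ≡ (if u then 0 else suc s) →
      (∀ y → suc c ≤ y → suc y ≤ B → g (suc y) ≡ y) →
      ∀ x → x ≤ B → g x ≡ chordCycle u s c x
    chordCycle-determined g B 1≤s s<c e0 e1 eL eM ec ec1 eR zero _ = e0
    chordCycle-determined g B 1≤s s<c e0 e1 eL eM ec ec1 eR (suc zero) _ = e1
    chordCycle-determined g B 1≤s s<c e0 e1 eL eM ec ec1 eR (suc (suc y)) hB with suc (suc y) ≤? s
    ... | yes h = trans (eL (suc y) (s≤s z≤n) h) (sym (chordCycle-left y h))
    ... | no ¬h with suc (suc y) <? c
    ...   | yes h2 = trans (eM _ (≰⇒> ¬h) h2) (sym (chordCycle-middle y (≰⇒> ¬h) h2))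
    ...   | no ¬h2 with m≤n⇒m<n∨m≡n (≮⇒≥ ¬h2)
    ...     | inj₂ refl = trans ec (sym (chordCycle-c (≤-trans (s≤s (s≤s z≤n)) (≤-reflexive refl)) s<c))
    ...     | inj₁ c<x with m≤n⇒m<n∨m≡n c<x
    ...       | inj₂ refl = trans ec1 (sym (chordCycle-1+c (≤-trans (s≤s z≤n) (≤-trans 1≤s (≤-trans (n≤1+n s) s<c))) s<c))
    ...       | inj₁ c1<x = trans (eR (suc y) (≤-pred c1<x) hB) (sym (chordCycle-right (suc y) s<c (≤-pred c1<x)))

  cycle₁ : ℕ → ℕ
  cycle₁ zero = 1
  cycle₁ x@(suc _) = if x <ᵇ 10 + 5 * m then suc x else 0

  cycle₂ : ℕ → ℕ
  cycle₂ zero = 3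
  cycle₂ (suc zero) = 0
  cycle₂ (suc (suc zero)) = 1
  cycle₂ x@(suc (suc (suc _))) = if x <ᵇ 10 + 5 * m then suc x else 2

  cycleₙ : ℕ → ℕ
  cycleₙ zero = 7 + 2 * m
  cycleₙ (suc zero) = 10 + 5 * m
  cycleₙ x@(suc (suc _)) = if x <ᵇ 8 + 2 * m then pred x else if x <ᵇ 9 + 2 * m then 0 else pred x

  cycle₁-step : ∀ x → suc x < 10 + 5 * m → cycle₁ (suc x) ≡ suc (suc x)
  cycle₁-step x h rewrite <⇒<ᵇ≡true {suc x} {10 + 5 * m} h = refl

  cycle₁-M : cycle₁ (10 + 5 * m) ≡ 0
  cycle₁-M rewrite ≥⇒<ᵇ≡false {10 + 5 * m} {10 + 5 * m} ≤-refl = refl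

  cycle₁-determined : (g : ℕ → ℕ) → g 0 ≡ 1 → (∀ x → suc x < 10 + 5 * m → g (suc x) ≡ suc (suc x)) → g (10 + 5 * m) ≡ 0 →
    ∀ x → x ≤ 10 + 5 * m → g x ≡ cycle₁ x
  cycle₁-determined g e0 eM eT zero _ = e0
  cycle₁-determined g e0 eM eT (suc x) h with m≤n⇒m<n∨m≡n h
  ... | inj₁ lt = trans (eM x lt) (sym (cycle₁-step x lt))
  ... | inj₂ refl = trans eT (sym cycle₁-M)

  cycle₂-step : ∀ x → 3 + x < 10 + 5 * m → cycle₂ (3 + x) ≡ 4 + x
  cycle₂-step x h rewrite <⇒<ᵇ≡true {3 + x} {10 + 5 * m} h = refl

  cycle₂-M : cycle₂ (10 + 5 * m) ≡ 2
  cycle₂-M rewrite ≥⇒<ᵇ≡false {10 + 5 * m} {10 + 5 * m} ≤-refl = refl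

  cycle₂-determined : (g : ℕ → ℕ) → g 0 ≡ 3 → g 1 ≡ 0 → g 2 ≡ 1 → (∀ x → 3 + x < 10 + 5 * m → g (3 + x) ≡ 4 + x) → g (10 + 5 * m) ≡ 2 →
    ∀ x → x ≤ 10 + 5 * m → g x ≡ cycle₂ x
  cycle₂-determined g e0 e1 e2 eM eT zero _ = e0
  cycle₂-determined g e0 e1 e2 eM eT (suc zero) _ = e1
  cycle₂-determined g e0 e1 e2 eM eT (suc (suc zero)) _ = e2
  cycle₂-determined g e0 e1 e2 eM eT (suc (suc (suc x))) h with m≤n⇒m<n∨m≡n h
  ... | inj₁ lt = trans (eM x lt) (sym (cycle₂-step x lt))
  ... | inj₂ refl = trans eT (sym cycle₂-M)

  cycleₙ-left : ∀ y → suc (suc y) ≤ 7 + 2 * m → cycleₙ (suc (suc y)) ≡ suc y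
  cycleₙ-left y h rewrite <⇒<ᵇ≡true {suc (suc y)} {8 + 2 * m} (s≤s h) = refl

  cycleₙ-8+2m : cycleₙ (8 + 2 * m) ≡ 0
  cycleₙ-8+2m rewrite ≥⇒<ᵇ≡false {8 + 2 * m} {8 + 2 * m} ≤-refl | <⇒<ᵇ≡true {8 + 2 * m} {9 + 2 * m} ≤-refl = refl

  cycleₙ-right : ∀ y → 8 + 2 * m ≤ y → cycleₙ (suc y) ≡ y
  cycleₙ-right (suc y) h rewrite ≥⇒<ᵇ≡false {suc (suc y)} {8 + 2 * m} (m≤n⇒m≤1+n h) | ≥⇒<ᵇ≡false {suc (suc y)} {9 + 2 * m} (s≤s h) = refl
  cycleₙ-right zero ()

  cycleₙ-determined : (g : ℕ → ℕ) → g 0 ≡ 7 + 2 * m → g 1 ≡ 10 + 5 * m →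
    (∀ y → 1 ≤ y → suc y ≤ 7 + 2 * m → g (suc y) ≡ y) → g (8 + 2 * m) ≡ 0 →
    (∀ y → 8 + 2 * m ≤ y → suc y ≤ 10 + 5 * m → g (suc y) ≡ y) → ∀ x → x ≤ 10 + 5 * m → g x ≡ cycleₙ x
  cycleₙ-determined g e0 e1 eL e8 eR zero _ = e0
  cycleₙ-determined g e0 e1 eL e8 eR (suc zero) _ = e1
  cycleₙ-determined g e0 e1 eL e8 eR (suc (suc y)) hB with suc (suc y) ≤? 7 + 2 * m
  ... | yes h = trans (eL (suc y) (s≤s z≤n) h) (sym (cycleₙ-left y h))
  ... | no ¬h with m≤n⇒m<n∨m≡n (≰⇒> ¬h)
  ...   | inj₂ refl = trans e8 (sym cycleₙ-8+2m)
  ...   | inj₁ lt = trans (eR (suc y) (≤-pred lt) hB) (sym (cycleₙ-right (suc y) (≤-pred lt)))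

  -- The Hamiltonian cycle through the in- and out-edge with label l + 1.
  hamCycle : ℕ → ℕ → ℕ
  hamCycle zero = cycle₁
  hamCycle (suc zero) = cycle₂
  hamCycle l@(suc (suc _)) = if l <ᵇ chordsB + 2 then chordCycle true (2 * l) (10 + 5 * m ∸ 3 * (l ∸ 1))
    else if l <ᵇ 3 + m then chordCycle false (1 + 2 * l) (7 + 2 * m + 3 * (2 + m ∸ l)) else cycleₙ

  hamCycle-chordB : ∀ i → suc i ≤ chordsB → hamCycle (suc (suc i)) ≡ chordCycle true (2 * suc (suc i)) (10 + 5 * m ∸ 3 * suc i)
  hamCycle-chordB i h rewrite <⇒<ᵇ≡true {suc (suc i)} {chordsB + 2} (subst (suc (suc (suc i)) ≤_) (+-comm 2 chordsB) (s≤s (s≤s h))) = refl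

  hamCycle-chordA : ∀ l → chordsB + 2 ≤ l → l < 3 + m → hamCycle l ≡ chordCycle false (1 + 2 * l) (7 + 2 * m + 3 * (2 + m ∸ l))
  hamCycle-chordA (suc (suc l')) h1 h2 rewrite ≥⇒<ᵇ≡false {suc (suc l')} {chordsB + 2} h1 | <⇒<ᵇ≡true {suc (suc l')} {3 + m} h2 = refl
  hamCycle-chordA zero p _ with subst (_≤ 0) (+-comm chordsB 2) p
  ... | ()
  hamCycle-chordA (suc zero) p _ with subst (_≤ 1) (+-comm chordsB 2) p
  ... | s≤s ()

  hamCycle-last : hamCycle (3 + m) ≡ cycleₙ
  hamCycle-last
    rewrite ≥⇒<ᵇ≡false {3 + m} {chordsB + 2} (subst (_≤ 3 + m) (+-comm 2 chordsB) (s≤s (s≤s (≤-trans chordsB≤m (n≤1+n m)))))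
          | ≥⇒<ᵇ≡false {3 + m} {3 + m} ≤-refl = refl

module Classification (m : ℕ) (f : ℕ → ℕ) (hs : IsHamSuccessor m f) where

  open Normalised m
  open ArcShapes m
  open TailPositions m
  open HamSuccessor m f hs
  open Candidates m
  open LowSplit

  f-arc≡ : ∀ {p y} → p ≤ M → f p ≡ y → Arc p y
  f-arc≡ {p} h refl = f-arc p h

  low-preimage-is-low : (L : LowSplit) → ∀ {z x} → z ≤ M → f z ≡ x → 1 ≤ x → x ≤ 7 + 2 * m → x ≢ gap L → z ≤ 7 + 2 * m
  low-preimage-is-low L {z} {x} hz fz 1≤x x≤ ne with suc x ≤? split L
  ... | yes h = ≤-trans (≤-reflexive (same-image⇒≡ hz (low≤M (≤-trans h (split≤ L))) fz (goesLeft L x 1≤x h))) (≤-trans h (split≤ L))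
  ... | no h with x ≟ split L | x ≟ suc (split L) | entry L
  ...   | yes refl | _ | inj₁ (_ , ee) = ⊥-elim (ne (sym ee))
  ...   | yes refl | _ | inj₂ (e0 , _) = ≤-trans (≤-reflexive (same-image⇒≡ hz 0≤M fz e0)) z≤n
  ...   | no _ | yes refl | inj₁ (e0 , _) = ≤-trans (≤-reflexive (same-image⇒≡ hz 0≤M fz e0)) z≤n
  ...   | no _ | yes refl | inj₂ (_ , ee) = ⊥-elim (ne (sym ee))
  ...   | no a | no b | _ with x | ≰⇒> h
  ...     | zero | _ = ⊥-elim (<⇒≱ 1≤x z≤n)
  ...     | suc x' | s≤s sx = ≤-trans (≤-reflexive (same-image⇒≡ hz (low≤M (≤-trans (n≤1+n x') x≤)) fz
                               (goesRight L x' s<x' (≤-pred x≤)))) (≤-trans (n≤1+n x') x≤)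
    where
    s≤x' : split L ≤ x'
    s≤x' with m≤n⇒m<n∨m≡n sx
    ... | inj₁ lt = ≤-pred lt
    ... | inj₂ eq = ⊥-elim (a (sym eq))
    s<x' : split L < x'
    s<x' with m≤n⇒m<n∨m≡n s≤x'
    ... | inj₁ lt = lt
    ... | inj₂ eq = ⊥-elim (b (sym (cong suc eq)))

  odd≢gap : (L : LowSplit) → ∀ p → 1 + 2 * p ≢ gap L
  odd≢gap L p eq with gap-even L
  ... | q , eq2 = even≢odd q p (sym (trans eq eq2))

  1≢gap : (L : LowSplit) → 1 ≢ gap L
  1≢gap L = odd≢gap L 0

  7+2m≢gap : (L : LowSplit) → 7 + 2 * m ≢ gap L
  7+2m≢gap L eq = odd≢gap L (3 + m) (trans 1+2[3+m]≡7+2m eq)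

  ascending-step-below : ∀ u → 8 + 2 * m ≤ u → suc u < M → f (suc u) ≡ suc (suc u) → f u ≡ suc u
  ascending-step-below u hu hlt e with preimage (suc u) (≤-trans (n≤1+n _) hlt)
  ... | p , p≤ , fp with arc-into-high (≤-trans hu (n≤1+n _)) (f-arc≡ p≤ fp)
  ...   | inj₁ eq = subst (λ z → f z ≡ suc u) (sym (suc-injective eq)) fp
  ...   | inj₂ (inj₁ refl) = ⊥-elim (no-2-cycle (≤-trans (n≤1+n _) hlt) hlt e fp)
  ...   | inj₂ (inj₂ (eq , _)) = ⊥-elim (<-irrefl eq hlt)

  ascending-run-below : ∀ t → f t ≡ suc t → t < M → ∀ d u → 8 + 2 * m ≤ u → u + d ≡ t → f u ≡ suc u
  ascending-run-below t et tM zero u hu eq = subst (λ z → f z ≡ suc z) (trans (sym eq) (+-identityʳ u)) et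
  ascending-run-below t et tM (suc d) u hu eq = ascending-step-below u hu lt (ascending-run-below t et tM d (suc u) (≤-trans hu (n≤1+n _)) (trans (sym (+-suc u d)) eq))
    where lt : suc u < M
          lt = ≤-<-trans (≤-trans (s≤s (m≤m+n u d)) (≤-reflexive (trans (sym (+-suc u d)) eq))) tM

  ascending-below : ∀ t → f t ≡ suc t → t < M → ∀ u → 8 + 2 * m ≤ u → u ≤ t → f u ≡ suc u
  ascending-below t et tM u hu ut = ascending-run-below t et tM (t ∸ u) u hu (m+[n∸m]≡n ut)

  descending-step-above : ∀ u → 8 + 2 * m ≤ u → suc u < M → f (suc u) ≡ u → f (suc (suc u)) ≡ suc u
  descending-step-above u hu hlt e with preimage (suc u) (≤-trans (n≤1+n _) hlt)
  ... | p , p≤ , fp with arc-into-high (≤-trans hu (n≤1+n _)) (f-arc≡ p≤ fp)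
  ...   | inj₁ eq = ⊥-elim (no-2-cycle (≤-trans (n≤1+n _) (≤-trans (n≤1+n _) hlt)) (≤-trans (n≤1+n _) hlt)
                      (subst (λ z → f z ≡ suc u) (sym (suc-injective eq)) fp) e)
  ...   | inj₂ (inj₁ refl) = fp
  ...   | inj₂ (inj₂ (eq , _)) = ⊥-elim (<-irrefl eq hlt)

  descending-run-above : ∀ b → 8 + 2 * m ≤ b → f (suc b) ≡ b → ∀ d → suc (b + d) ≤ M → f (suc (b + d)) ≡ b + d
  descending-run-above b hb e zero _ = subst (λ z → f (suc z) ≡ z) (sym (+-identityʳ b)) e
  descending-run-above b hb e (suc d) h = subst (λ z → f (suc z) ≡ z) (sym (+-suc b d))
    (descending-step-above (b + d) (≤-trans hb (m≤m+n b d)) (subst (λ z → suc z ≤ M) (+-suc b d) h)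
      (descending-run-above b hb e d (≤-trans (s≤s (≤-trans (n≤1+n _) (≤-reflexive (sym (+-suc b d))))) h)))

  descending-above : ∀ b → 8 + 2 * m ≤ b → f (suc b) ≡ b → ∀ y → b ≤ y → suc y ≤ M → f (suc y) ≡ y
  descending-above b hb e y by h = subst (λ z → f (suc z) ≡ z) (m+[n∸m]≡n by) (descending-run-above b hb e (y ∸ b) (subst (λ z → suc z ≤ M) (sym (m+[n∸m]≡n by)) h))

  ascending-between : (L : LowSplit) → f (7 + 2 * m) ≡ 8 + 2 * m → ∀ c → (∀ u → 8 + 2 * m ≤ u → u < c → f u ≡ suc u) →
          ∀ x → split L < x → x < c → f x ≡ suc x
  ascending-between L fT8 c H x h1 h2 with x ≤? 6 + 2 * m
  ... | yes a = goesRight L x h1 a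
  ... | no a with m≤n⇒m<n∨m≡n (≰⇒> a)
  ...   | inj₂ refl = fT8
  ...   | inj₁ lt = H x lt h2

  chordCycle-determined-≡ : ∀ u s' c' s0 c0 → s' ≡ s0 → c' ≡ c0 → 1 ≤ s0 → s0 < c0 →
      f 0 ≡ (if u then suc s0 else s0) → f 1 ≡ 10 + 5 * m →
      (∀ y → 1 ≤ y → suc y ≤ s0 → f (suc y) ≡ y) →
      (∀ x → s0 < x → x < c0 → f x ≡ suc x) →
      f c0 ≡ (if u then s0 else 0) → f (suc c0) ≡ (if u then 0 else suc s0) →
      (∀ y → suc c0 ≤ y → suc y ≤ M → f (suc y) ≡ y) →
      ∀ x → x ≤ M → f x ≡ chordCycle u s' c' x
  chordCycle-determined-≡ u s' c' .s' .c' refl refl = chordCycle-determined u s' c' f M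

  MatchesCandidate : Set
  MatchesCandidate = ∃ λ l → l ≤ 3 + m × (∀ x → x ≤ M → f x ≡ hamCycle l x)

  f0≤7+2m : (L : LowSplit) → f 0 ≤ 7 + 2 * m
  f0≤7+2m L = ≤-trans (≤-reflexive (f0≡ L)) (≤-trans (+-monoʳ-≤ 1 (*-monoʳ-≤ 2 (label≤ L))) (≤-reflexive 1+2[3+m]≡7+2m))

  ¬confined-low : (L : LowSplit) → f 1 ≤ 7 + 2 * m → f (7 + 2 * m) ≤ 7 + 2 * m → ⊥
  ¬confined-low L f1≤ fT≤ = f-closed⇒¬excludes (_≤ 7 + 2 * m) cl 0≤M ≤-refl z≤n (λ p → ≤⇒≯ p 8+2m≤M)
    where
    cl : ∀ z → z ≤ M → z ≤ 7 + 2 * m → f z ≤ 7 + 2 * m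
    cl zero _ _ = f0≤7+2m L
    cl (suc z) zM zT with arc-from-low (s≤s z≤n) zT (f-arc (suc z) zM)
    ... | inj₁ e = ≤-trans (≤-reflexive (suc-injective e)) (≤-trans (n≤1+n z) zT)
    ... | inj₂ (inj₂ (inj₂ (e , _))) = ≡0⇒≤ e
    ... | inj₂ (inj₂ (inj₁ (refl , _))) = f1≤
    ... | inj₂ (inj₁ e) with m≤n⇒m<n∨m≡n zT
    ...   | inj₁ lt = ≤-trans (≤-reflexive e) lt
    ...   | inj₂ refl = fT≤

  2≤7+2m : 2 ≤ 7 + 2 * m
  2≤7+2m = s≤s (s≤s z≤n)

  classify-ascendingHigh : (L : LowSplit) → f (7 + 2 * m) ≡ 8 + 2 * m → (f 1 ≡ 0 ⊎ (split L ≡ 0 × f 1 ≡ 2)) → MatchesCandidate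
  classify-ascendingHigh L fT8 f1lo = by-arc-from-M f1lo (arc-from-high 8+2m≤M (f-arc M ≤-refl))
    where
    fM1 : f (9 + 5 * m) ≡ M
    fM1 with preimage M ≤-refl
    ... | p , p≤ , fp with arc-into-high 8+2m≤M (f-arc≡ p≤ fp)
    ...   | inj₁ eq = subst (λ z → f z ≡ M) (sym (suc-injective eq)) fp
    ...   | inj₂ (inj₁ refl) = ⊥-elim (1+n≰n p≤)
    ...   | inj₂ (inj₂ (_ , refl)) = ⊥-elim (aux f1lo)
      where aux : (f 1 ≡ 0 ⊎ (split L ≡ 0 × f 1 ≡ 2)) → ⊥
            aux (inj₁ e) = 1+n≢0 (trans (sym fp) e)
            aux (inj₂ (_ , e)) with trans (sym fp) e
            ... | ()
    H : ∀ u → 8 + 2 * m ≤ u → u < M → f u ≡ suc u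
    H u hu lt = ascending-below (9 + 5 * m) fM1 ≤-refl u hu (≤-pred lt)
    by-arc-from-M : (f 1 ≡ 0 ⊎ (split L ≡ 0 × f 1 ≡ 2)) → ArcFromHigh M (f M) → MatchesCandidate
    by-arc-from-M _ (inj₁ e) = ⊥-elim (no-2-cycle (≤-trans (n≤1+n _) ≤-refl) ≤-refl fM1 (suc-injective e))
    by-arc-from-M _ (inj₂ (inj₁ e)) = ⊥-elim (1+n≰n (subst (_≤ M) e (f-bounded M ≤-refl)))
    by-arc-from-M _ (inj₂ (inj₂ (inj₁ (_ , e)))) = ⊥-elim (≤⇒≯ (low-preimage-is-low L ≤-refl e (s≤s z≤n) (s≤s z≤n) (1≢gap L)) 8+2m≤M)
    by-arc-from-M _ (inj₂ (inj₂ (inj₂ (inj₁ ch)))) with chord-from-M ch | 2 ≟ gap L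
    ... | fM2 | no ne = ⊥-elim (≤⇒≯ (low-preimage-is-low L ≤-refl fM2 (s≤s z≤n) 2≤7+2m ne) 8+2m≤M)
    ... | fM2 | yes 2e with entry L
    ...   | inj₂ (f0 , ee) = ⊥-elim (¬split≡1 (suc-injective (trans (sym ee) (sym 2e))) f1lo)
      where
      ¬split≡1 : split L ≡ 1 → (f 1 ≡ 0 ⊎ (split L ≡ 0 × f 1 ≡ 2)) → ⊥
      ¬split≡1 s1 (inj₁ f10) = no-2-cycle 0≤M 1≤M (trans f0 s1) f10
      ¬split≡1 s1 (inj₂ (s0 , _)) with trans (sym s0) s1
      ... | ()
    ...   | inj₁ (f0 , ee) = 1 , s≤s z≤n , cycle₂-determined f f03 f10 f21 mid fM2
      where
      s2 : split L ≡ 2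
      s2 = trans (sym ee) (sym 2e)
      f03 : f 0 ≡ 3
      f03 = trans f0 (cong suc s2)
      f10' : (f 1 ≡ 0 ⊎ (split L ≡ 0 × f 1 ≡ 2)) → f 1 ≡ 0
      f10' (inj₁ e) = e
      f10' (inj₂ (s0 , _)) with trans (sym s0) s2
      ... | ()
      f10 : f 1 ≡ 0
      f10 = f10' f1lo
      f21 : f 2 ≡ 1
      f21 = goesLeft L 1 (s≤s z≤n) (≤-reflexive (sym s2))
      mid : ∀ x → 3 + x < M → f (3 + x) ≡ 4 + x
      mid x lt = ascending-between L fT8 M H (3 + x) (subst (_< 3 + x) (sym s2) (s≤s (s≤s (s≤s z≤n)))) lt
    by-arc-from-M (inj₁ f10) (inj₂ (inj₂ (inj₂ (inj₂ (fM0 , _))))) with same-image⇒≡ ≤-refl 1≤M fM0 f10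
    ... | ()
    by-arc-from-M (inj₂ (s0 , f12)) (inj₂ (inj₂ (inj₂ (inj₂ (fM0 , _))))) with entry L
    ... | inj₂ (f0 , _) with trans (sym (f0≡ L)) (trans f0 s0)
    ...   | ()
    by-arc-from-M (inj₂ (s0 , f12)) (inj₂ (inj₂ (inj₂ (inj₂ (fM0 , _))))) | inj₁ (f0 , _) = 0 , z≤n , cycle₁-determined f f01 mid fM0
      where
      f01 : f 0 ≡ 1
      f01 = trans f0 (cong suc s0)
      mid : ∀ x → suc x < M → f (suc x) ≡ suc (suc x)
      mid x lt = ascending-between L fT8 M H (suc x) (subst (_< suc x) (sym s0) (s≤s z≤n)) lt

  1+2[2+m]≡5+2m : 1 + 2 * (2 + m) ≡ 5 + 2 * m
  1+2[2+m]≡5+2m = cong suc (*-distribˡ-+ 2 2 m)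

  2+n≢n : ∀ {a} → suc (suc a) ≡ a → ⊥
  2+n≢n e = 1+n≰n (≤-trans (n≤1+n _) (≤-reflexive e))

  classify-descendingHigh : (L : LowSplit) → f 1 ≡ M → ((split L ≤ 6 + 2 * m × f (7 + 2 * m) ≡ 0) ⊎ (split L ≡ 7 + 2 * m × f (7 + 2 * m) ≡ 6 + 2 * m)) → MatchesCandidate
  classify-descendingHigh L f1M fTlo = by-arc-from-8+2m fTlo (arc-from-high ≤-refl (f-arc (8 + 2 * m) 8+2m≤M))
    where
    f9 : f (9 + 2 * m) ≡ 8 + 2 * m
    f9 with preimage (8 + 2 * m) 8+2m≤M
    ... | p , p≤ , fp with arc-into-high ≤-refl (f-arc≡ p≤ fp)
    ...   | inj₁ eq = ⊥-elim (aux fTlo)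
      where aux : ((split L ≤ 6 + 2 * m × f (7 + 2 * m) ≡ 0) ⊎ (split L ≡ 7 + 2 * m × f (7 + 2 * m) ≡ 6 + 2 * m)) → ⊥
            aux (inj₁ (_ , e)) with trans (sym (subst (λ z → f z ≡ 8 + 2 * m) (sym (suc-injective eq)) fp)) e
            ... | ()
            aux (inj₂ (_ , e)) = 2+n≢n (trans (sym (subst (λ z → f z ≡ 8 + 2 * m) (sym (suc-injective eq)) fp)) e)
    ...   | inj₂ (inj₁ refl) = fp
    ...   | inj₂ (inj₂ (eq , _)) = ⊥-elim (≤⇒≯ ≤-refl (≤-trans 9+2m≤M (≤-reflexive (sym eq))))
    Wr : ∀ y → 8 + 2 * m ≤ y → suc y ≤ M → f (suc y) ≡ y
    Wr = descending-above (8 + 2 * m) ≤-refl f9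
    by-arc-from-8+2m : ((split L ≤ 6 + 2 * m × f (7 + 2 * m) ≡ 0) ⊎ (split L ≡ 7 + 2 * m × f (7 + 2 * m) ≡ 6 + 2 * m)) →
      ArcFromHigh (8 + 2 * m) (f (8 + 2 * m)) → MatchesCandidate
    by-arc-from-8+2m _ (inj₁ e) = ⊥-elim (≤⇒≯ (low-preimage-is-low L 8+2m≤M (suc-injective e) (s≤s z≤n) ≤-refl (7+2m≢gap L)) ≤-refl)
    by-arc-from-8+2m _ (inj₂ (inj₁ e)) = ⊥-elim (no-2-cycle 8+2m≤M 9+2m≤M e f9)
    by-arc-from-8+2m _ (inj₂ (inj₂ (inj₁ (eq , _)))) = ⊥-elim (≤⇒≯ ≤-refl (≤-trans 9+2m≤M (≤-reflexive (sym eq))))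
    by-arc-from-8+2m fTl (inj₂ (inj₂ (inj₂ (inj₁ ch)))) with chord-from-8+2m ch | 6 + 2 * m ≟ gap L
    ... | fP6 | no ne = ⊥-elim (≤⇒≯ (low-preimage-is-low L 8+2m≤M fP6 (s≤s z≤n) (n≤1+n _) ne) ≤-refl)
    ... | fP6 | yes 6e with entry L | fTl
    ...   | inj₁ (f0 , ee) | inj₁ (_ , fT0) = ⊥-elim (no-2-cycle 0≤M 7+2m≤M (trans f0 (cong suc (trans (sym ee) (sym 6e)))) fT0)
    ...   | inj₁ (f0 , ee) | inj₂ (sT , _) = ⊥-elim (1+n≢n (trans (sym sT) (trans (sym ee) (sym 6e))))
    ...   | inj₂ (f0 , ee) | inj₂ (sT , _) = ⊥-elim (2+n≢n (trans (cong suc (sym sT)) (trans (sym ee) (sym 6e))))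
    ...   | inj₂ (f0 , ee) | inj₁ (_ , fT0) = 2 + m , n≤1+n _ ,
              λ x hx → trans (chordCycle-determined-≡ false (1 + 2 * (2 + m)) (7 + 2 * m + 3 * (2 + m ∸ (2 + m))) (split L) (7 + 2 * m)
                 (trans 1+2[2+m]≡5+2m (sym s5)) c≡ (subst (1 ≤_) (sym s5) (s≤s z≤n)) (subst (_< 7 + 2 * m) (sym s5) (n≤1+n _))
                 f0 f1M (goesLeft L) (λ y h1 h2 → goesRight L y h1 (≤-pred h2)) fT0 (trans fP6 (sym (trans (sym ee) (sym 6e)))) Wr x hx)
                 (sym (cong (λ g → g x) (hamCycle-chordA (2 + m) F2≤ ≤-refl)))
      where
      s5 : split L ≡ 5 + 2 * m
      s5 = suc-injective (trans (sym ee) (sym 6e))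
      c≡ : 7 + 2 * m + 3 * (2 + m ∸ (2 + m)) ≡ 7 + 2 * m
      c≡ = trans (cong (λ z → 7 + 2 * m + 3 * z) (n∸n≡0 (2 + m))) (+-identityʳ _)
      F2≤ : chordsB + 2 ≤ 2 + m
      F2≤ = subst (_≤ 2 + m) (+-comm 2 chordsB) (s≤s (s≤s chordsB≤m))
    by-arc-from-8+2m (inj₁ (_ , fT0)) (inj₂ (inj₂ (inj₂ (inj₂ (fP0 , _))))) with same-image⇒≡ 8+2m≤M 7+2m≤M fP0 fT0
    ... | eq = ⊥-elim (1+n≰n (≤-reflexive eq))
    by-arc-from-8+2m (inj₂ (sT , fT6)) (inj₂ (inj₂ (inj₂ (inj₂ (fP0 , _))))) with entry L
    ... | inj₁ (f0 , _) = ⊥-elim (1+n≰n (≤-trans (≤-reflexive (trans (cong suc (sym sT)) (sym f0))) (f0≤7+2m L)))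
    ... | inj₂ (f0 , _) = 3 + m , ≤-refl , λ x hx → trans (cycleₙ-determined f (trans f0 sT) f1M lt fP0 Wr x hx) (sym (cong (λ g → g x) hamCycle-last))
      where lt : ∀ y → 1 ≤ y → suc y ≤ 7 + 2 * m → f (suc y) ≡ y
            lt y h1 h2 = goesLeft L y h1 (subst (suc y ≤_) (sym sT) h2)

  LeavesByChordOrToV : ℕ → Set
  LeavesByChordOrToV x = Chord x (f x) ⊎ (f x ≡ 0 × ∃ λ l → l ≤ 3 + m × Tail l x)

  label+i≡2+m : ∀ l i m → (2 + 2 * l) + 2 * suc i ≡ 6 + 2 * m → l + suc i ≡ 2 + m
  label+i≡2+m l i m e = *-cancelˡ-≡ _ _ 2 (+-cancelˡ-≡ 2 _ _ (trans (lem1 l i) (trans e (lem2 m))))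
    where lem1 : ∀ l i → 2 + 2 * (l + suc i) ≡ (2 + 2 * l) + 2 * suc i
          lem1 = solve-∀
          lem2 : ∀ m → 6 + 2 * m ≡ 2 + 2 * (2 + m)
          lem2 = solve-∀

  first-non-ascending : f 1 ≡ M → ∀ d k → k + d ≡ 1 + 3 * m → (∀ u → 8 + 2 * m ≤ u → u < 8 + 2 * m + k → f u ≡ suc u) →
         Σ ℕ λ c → 8 + 2 * m ≤ c × c ≤ 9 + 5 * m × (∀ u → 8 + 2 * m ≤ u → u < c → f u ≡ suc u) × ¬ (f c ≡ suc c)
  first-non-ascending f1M d k e H with f (8 + 2 * m + k) ≟ suc (8 + 2 * m + k)
  ... | no ne = 8 + 2 * m + k , m≤m+n _ _ , bnd , H , ne
    where bnd : 8 + 2 * m + k ≤ 9 + 5 * m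
          bnd = ≤-trans (+-monoʳ-≤ (8 + 2 * m) (≤-trans (m≤m+n k d) (≤-reflexive e))) (≤-reflexive (lem m))
            where lem : ∀ m → 8 + 2 * m + (1 + 3 * m) ≡ 9 + 5 * m
                  lem = solve-∀
  ... | yes eq with d
  ...   | zero = ⊥-elim (1+n≢0 (suc-injective (same-image⇒≡ (≤-trans (≤-reflexive kk) (n≤1+n _)) 1≤M (trans eq (cong suc kk)) f1M)))
    where kk : 8 + 2 * m + k ≡ 9 + 5 * m
          kk = trans (cong (8 + 2 * m +_) (trans (sym (+-identityʳ k)) e)) (lem m)
            where lem : ∀ m → 8 + 2 * m + (1 + 3 * m) ≡ 9 + 5 * m
                  lem = solve-∀
  ...   | suc d' = first-non-ascending f1M d' (suc k) (trans (sym (+-suc k d')) e) H'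
    where H' : ∀ u → 8 + 2 * m ≤ u → u < 8 + 2 * m + suc k → f u ≡ suc u
          H' u hu lt with m≤n⇒m<n∨m≡n (≤-pred (subst (suc u ≤_) (+-suc (8 + 2 * m) k) lt))
          ... | inj₁ lt2 = H u hu lt2
          ... | inj₂ refl = eq

  module ChordHigh (L : LowSplit) (f1M : f 1 ≡ M) (1≤s : 1 ≤ split L) (s≤6 : split L ≤ 6 + 2 * m)
    (fT8 : f (7 + 2 * m) ≡ 8 + 2 * m) (c : ℕ) (cW : 8 + 2 * m ≤ c) (c≤ : c ≤ 9 + 5 * m)
    (Hc : ∀ u → 8 + 2 * m ≤ u → u < c → f u ≡ suc u) (ncs : ¬ (f c ≡ suc c)) where

    cM : c ≤ M
    cM = ≤-trans c≤ (n≤1+n _)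
    c1M : suc c ≤ M
    c1M = s≤s c≤
    descending-after-c : ∀ y → suc c ≤ y → suc y ≤ M → f (suc y) ≡ y
    descending-after-c with suc c ≤? 9 + 5 * m
    ... | yes sc< = descending-above (suc c) (≤-trans cW (n≤1+n _)) base
      where
      base : f (suc (suc c)) ≡ suc c
      base with preimage (suc c) c1M
      ... | p , p≤ , fp with arc-into-high (≤-trans cW (n≤1+n _)) (f-arc≡ p≤ fp)
      ...   | inj₁ eq = ⊥-elim (ncs (subst (λ z → f z ≡ suc c) (sym (suc-injective eq)) fp))
      ...   | inj₂ (inj₁ refl) = fp
      ...   | inj₂ (inj₂ (eq , _)) = ⊥-elim (1+n≰n (≤-trans (≤-reflexive (sym eq)) sc<))
    ... | no ¬sc = λ y h1 h2 → ⊥-elim (¬sc (≤-pred (≤-trans (s≤s h1) h2)))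
    q : ℕ
    q = pred c
    qc : suc q ≡ c
    qc = suc-pred c ⦃ >-nonZero (≤-trans (s≤s z≤n) cW) ⦄
    fq : f q ≡ c
    fq with 8 + 2 * m ≤? q
    ... | yes w = trans (Hc q w (≤-reflexive qc)) qc
    ... | no nw = trans (cong f q7) (trans fT8 (trans (cong suc (sym q7)) qc))
      where q7 : q ≡ 7 + 2 * m
            q7 = ≤-antisym (≤-pred (≰⇒> nw)) (≤-pred (≤-trans cW (≤-reflexive (sym qc))))
    qM : q ≤ M
    qM = ≤-trans (n≤1+n q) (≤-trans (≤-reflexive qc) cM)
    leaves-c : LeavesByChordOrToV c
    leaves-c with arc-from-high cW (f-arc c cM)
    ... | inj₁ e = ⊥-elim (no-2-cycle qM cM fq (suc-injective (trans e (sym qc))))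
    ... | inj₂ (inj₁ e) = ⊥-elim (ncs e)
    ... | inj₂ (inj₂ (inj₁ (eq , _))) = ⊥-elim (1+n≰n (≤-trans (≤-reflexive (sym eq)) c≤))
    ... | inj₂ (inj₂ (inj₂ x)) = x
    leaves-1+c : LeavesByChordOrToV (suc c)
    leaves-1+c with arc-from-high (≤-trans cW (n≤1+n _)) (f-arc (suc c) c1M)
    ... | inj₁ e = ⊥-elim (2+n≢n (trans (cong suc (same-image⇒≡ c1M qM (suc-injective e) fq)) qc))
    ... | inj₂ (inj₁ e) with suc c ≤? 9 + 5 * m
    ...   | yes sc< = ⊥-elim (no-2-cycle c1M (s≤s sc<) e (descending-after-c (suc c) ≤-refl (s≤s sc<)))
    ...   | no ¬sc = ⊥-elim (¬sc (≤-pred (≤-trans (≤-reflexive (sym e)) (f-bounded (suc c) c1M))))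
    leaves-1+c | inj₂ (inj₂ (inj₁ (_ , e))) = ⊥-elim (≤⇒≯ (low-preimage-is-low L c1M e (s≤s z≤n) (s≤s z≤n) (1≢gap L)) (≤-trans cW (n≤1+n _)))
    leaves-1+c | inj₂ (inj₂ (inj₂ x)) = x
    chord-hits-gap : ∀ {x} → x ≤ M → 8 + 2 * m ≤ x → Chord x (f x) → f x ≡ gap L
    chord-hits-gap {x} xM xW ch with f x ≟ gap L
    ... | yes p = p
    ... | no ne with chord-target ch
    ...   | lo , hi , _ = ⊥-elim (≤⇒≯ (low-preimage-is-low L xM refl (≤-trans (s≤s z≤n) lo) (≤-trans hi (n≤1+n _)) ne) xW)
    s<c : split L < c
    s<c = ≤-trans (s≤s s≤6) (≤-trans (n≤1+n _) cW)
    entry-at-split⇒misses-high : f 0 ≡ split L → f (suc c) ≡ 0 → ⊥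
    entry-at-split⇒misses-high f0 fc10 = f-closed⇒¬excludes Q cl 0≤M 8+2m≤M (inj₁ z≤n) nq
      where
      Q : ℕ → Set
      Q z = z ≤ split L ⊎ suc c ≤ z
      cl : ∀ z → z ≤ M → Q z → Q (f z)
      cl zero _ _ = inj₁ (≤-reflexive f0)
      cl (suc zero) _ _ = inj₂ (≤-trans c1M (≤-reflexive (sym f1M)))
      cl (suc (suc y)) _ (inj₁ h) = inj₁ (≤-trans (≤-reflexive (goesLeft L (suc y) (s≤s z≤n) h)) (≤-trans (n≤1+n _) h))
      cl z zM (inj₂ h) with m≤n⇒m<n∨m≡n h
      ... | inj₂ refl = inj₁ (≡0⇒≤ fc10)
      ... | inj₁ lt with z | lt
      ...   | suc y | s≤s cy = inj₂ (≤-trans cy (≤-reflexive (sym (descending-after-c y cy zM))))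
      nq : ¬ Q (8 + 2 * m)
      nq (inj₁ p) = ≤⇒≯ s≤6 (≤-trans (n≤1+n _) p)
      nq (inj₂ p) = 1+n≰n (≤-trans p cW)
    entry-after-split⇒misses-1 : f 0 ≡ suc (split L) → f c ≡ 0 → ⊥
    entry-after-split⇒misses-1 f0 fc0 = f-closed⇒¬excludes Q cl 0≤M 1≤M (inj₁ refl) nq
      where
      Q : ℕ → Set
      Q z = z ≡ 0 ⊎ (suc (split L) ≤ z × z ≤ c)
      cl : ∀ z → z ≤ M → Q z → Q (f z)
      cl z _ (inj₁ refl) = inj₂ (≤-reflexive (sym f0) , ≤-trans (≤-reflexive f0) s<c)
      cl z _ (inj₂ (a , b)) with m≤n⇒m<n∨m≡n b
      ... | inj₂ refl = inj₁ fc0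
      ... | inj₁ lt = inj₂ (≤-trans a (≤-trans (n≤1+n _) (≤-reflexive (sym fz))) , ≤-trans (≤-reflexive fz) lt)
        where fz : f z ≡ suc z
              fz = ascending-between L fT8 c Hc z a lt
      nq : ¬ Q 1
      nq (inj₁ ())
      nq (inj₂ (a , _)) = <⇒≱ (≤-trans (s≤s 1≤s) a) ≤-refl
    ¬both-chords : Chord c (f c) → Chord (suc c) (f (suc c)) → ⊥
    ¬both-chords ch ch1 with preimage 0 0≤M
    ... | z , zM , fz = go z zM fz
      where
      tgt : ∀ {x} → Chord x (f x) → f x ≡ 0 → ⊥
      tgt ch0 e0 with chord-target ch0
      ... | lo , _ = <⇒≱ (s≤s z≤n) (≤-trans lo (≤-reflexive e0))
      go : ∀ z → z ≤ M → f z ≡ 0 → ⊥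
      go zero _ e0 = 1+n≢0 (trans (sym (f0≡ L)) e0)
      go (suc zero) _ e0 = 1+n≢0 (trans (sym f1M) e0)
      go z@(suc (suc z')) zM e0 with z ≤? 6 + 2 * m
      ... | yes h with low-step z (s≤s (s≤s z≤n)) h
      ...   | inj₁ e = 1+n≢0 (suc-injective (trans (sym e) (cong suc e0)))
      ...   | inj₂ e = 1+n≢0 (trans (sym e) e0)
      go z@(suc (suc z')) zM e0 | no h with m≤n⇒m<n∨m≡n (≰⇒> h)
      ...   | inj₂ refl = 1+n≢0 (trans (sym fT8) e0)
      ...   | inj₁ zW with z <? c
      ...     | yes zc = 1+n≢0 (trans (sym (Hc z zW zc)) e0)
      ...     | no zc with m≤n⇒m<n∨m≡n (≮⇒≥ zc)
      ...       | inj₂ refl = tgt ch e0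
      ...       | inj₁ cz with m≤n⇒m<n∨m≡n cz
      ...         | inj₂ refl = tgt ch1 e0
      ...         | inj₁ c1z = 1+n≢0 (trans (sym (descending-after-c (suc z') (≤-pred c1z) zM)) e0)
    result-chordB : ∀ i → suc i ≤ chordsB → c + 3 * suc i ≡ 10 + 5 * m → f c ≡ 2 + 2 * suc i → f c ≡ gap L →
            f 0 ≡ suc (split L) → gap L ≡ split L → f (suc c) ≡ 0 → MatchesCandidate
    result-chordB i i≤ ce yeq ye f0 ee fc10 = suc (suc i) , lb ,
      λ x hx → trans (chordCycle-determined-≡ true (2 * suc (suc i)) (10 + 5 * m ∸ 3 * suc i) (split L) c s'≡ c'≡ 1≤s s<c f0 f1M (goesLeft L)
                        (ascending-between L fT8 c Hc) (trans ye ee) fc10 descending-after-c x hx)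
                     (sym (cong (λ g → g x) (hamCycle-chordB i i≤)))
      where
      lb : suc (suc i) ≤ 3 + m
      lb = ≤-trans (s≤s (≤-trans i≤ chordsB≤m)) (≤-trans (n≤1+n _) (n≤1+n _))
      s'≡ : 2 * suc (suc i) ≡ split L
      s'≡ = trans (*-distribˡ-+ 2 1 (suc i)) (trans (sym yeq) (trans ye ee))
      c'≡ : 10 + 5 * m ∸ 3 * suc i ≡ c
      c'≡ = sym (+≡⇒≡∸ ce)
    result-chordA : ∀ i → suc i ≤ chordsA → suc c ≡ 8 + 2 * m + 3 * suc i → f (suc c) + 2 * suc i ≡ 6 + 2 * m → f (suc c) ≡ gap L →
            f 0 ≡ split L → gap L ≡ suc (split L) → f c ≡ 0 → MatchesCandidate
    result-chordA i i≤ c1eq yeq ye f0 ee fc0 = label L , label≤ L ,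
      λ x hx → trans (chordCycle-determined-≡ false (1 + 2 * label L) (7 + 2 * m + 3 * (2 + m ∸ label L)) (split L) c s'≡ c'≡ 1≤s s<c f0 f1M (goesLeft L)
                        (ascending-between L fT8 c Hc) fc0 (trans ye ee) descending-after-c x hx)
                     (sym (cong (λ g → g x) (hamCycle-chordA (label L) F2≤ l<)))
      where
      s'≡ : 1 + 2 * label L ≡ split L
      s'≡ = trans (sym (f0≡ L)) f0
      li : label L + suc i ≡ 2 + m
      li = label+i≡2+m (label L) i m (trans (cong (_+ 2 * suc i) (trans (cong suc s'≡) (trans (sym ee) (sym ye)))) yeq)
      F2≤ : chordsB + 2 ≤ label L
      F2≤ = +-cancelʳ-≤ (suc i) (chordsB + 2) (label L)
              (≤-trans (+-monoʳ-≤ (chordsB + 2) i≤) (≤-reflexive (trans (lem chordsB chordsA) (trans (cong (2 +_) chordsB+chordsA≡m) (sym li)))))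
        where lem : ∀ chordsB chordsA → chordsB + 2 + chordsA ≡ 2 + (chordsB + chordsA)
              lem = solve-∀
      l< : label L < 3 + m
      l< = ≤-trans (s≤s (m≤m+n (label L) (suc i))) (≤-reflexive (cong suc li))
      c'≡ : 7 + 2 * m + 3 * (2 + m ∸ label L) ≡ c
      c'≡ = trans (cong (λ z → 7 + 2 * m + 3 * z) (trans (cong (_∸ label L) (sym li)) (m+n∸m≡n (label L) (suc i)))) (sym (suc-injective c1eq))
    result : MatchesCandidate
    result with leaves-c | leaves-1+c
    ... | inj₁ ch | inj₁ ch1 = ⊥-elim (¬both-chords ch ch1)
    ... | inj₂ (fc0 , _) | inj₂ (fc10 , _) = ⊥-elim (1+n≰n (≤-reflexive (sym (same-image⇒≡ cM c1M fc0 fc10))))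
    ... | inj₁ ch | inj₂ (fc10 , _ , _ , tl) with entry L | chord-hits-gap cM cW ch
    ...   | inj₂ (f0 , ee) | _ = ⊥-elim (entry-at-split⇒misses-high f0 fc10)
    ...   | inj₁ (f0 , ee) | ye with ch
    ...     | isExtA eq _ = ⊥-elim (no-tail-after-extA-source (subst (λ z → Tail _ (suc z)) eq tl))
    ...     | isExtB eq _ = ⊥-elim (1+n≰n (≤-trans (≤-reflexive (sym eq)) c≤))
    ...     | isChordA i _ eq _ = ⊥-elim (no-tail-after-chordA-source i (subst (λ z → Tail _ (suc z)) eq tl))
    ...     | isChordB i i≤ ce yeq = result-chordB i i≤ ce yeq ye f0 ee fc10
    result | inj₂ (fc0 , _ , _ , tl) | inj₁ ch1 with entry L | chord-hits-gap c1M (≤-trans cW (n≤1+n _)) ch1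
    ...   | inj₁ (f0 , ee) | _ = ⊥-elim (entry-after-split⇒misses-1 f0 fc0)
    ...   | inj₂ (f0 , ee) | ye with ch1
    ...     | isExtA eq _ = ⊥-elim (1+n≰n (≤-trans cW (≤-reflexive (suc-injective eq))))
    ...     | isExtB eq _ = ⊥-elim (no-tail-before-M (subst (Tail _) (suc-injective eq) tl))
    ...     | isChordA i i≤ eq yeq = result-chordA i i≤ eq yeq ye f0 ee fc0
    ...     | isChordB i i≤ eq _ = ⊥-elim (no-tail-before-chordB-source c i cW eq tl)

  classify-chordHigh : (L : LowSplit) → f 1 ≡ M → 1 ≤ split L → split L ≤ 6 + 2 * m → f (7 + 2 * m) ≡ 8 + 2 * m → MatchesCandidate
  classify-chordHigh L f1M 1≤s s≤6 fT8 with first-non-ascending f1M (1 + 3 * m) 0 refl (λ u hu lt → ⊥-elim (<⇒≱ (subst (u <_) (+-identityʳ _) lt) hu))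
  ... | c , cW , c≤ , Hc , ncs = ChordHigh.result L f1M 1≤s s≤6 fT8 c cW c≤ Hc ncs

  classify : MatchesCandidate
  classify with lowSplit
  ... | L with at1 L | at7+2m L
  ...   | inj₁ (1≤s , inj₁ f1M) | inj₁ (s≤6 , inj₁ fT8) = classify-chordHigh L f1M 1≤s s≤6 fT8
  ...   | inj₁ (_ , inj₁ f1M) | inj₁ (s≤6 , inj₂ fT0) = classify-descendingHigh L f1M (inj₁ (s≤6 , fT0))
  ...   | inj₁ (_ , inj₁ f1M) | inj₂ x = classify-descendingHigh L f1M (inj₂ x)
  ...   | inj₁ (_ , inj₂ f10) | inj₁ (_ , inj₁ fT8) = classify-ascendingHigh L fT8 (inj₁ f10)
  ...   | inj₂ x | inj₁ (_ , inj₁ fT8) = classify-ascendingHigh L fT8 (inj₂ x)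
  ...   | inj₁ (_ , inj₂ f10) | inj₁ (_ , inj₂ fT0) = ⊥-elim (¬confined-low L (≡0⇒≤ f10) (≡0⇒≤ fT0))
  ...   | inj₁ (_ , inj₂ f10) | inj₂ (_ , fT6) = ⊥-elim (¬confined-low L (≡0⇒≤ f10) (≤-trans (≤-reflexive fT6) (n≤1+n _)))
  ...   | inj₂ (_ , f12) | inj₁ (_ , inj₂ fT0) = ⊥-elim (¬confined-low L (≤-trans (≤-reflexive f12) 2≤7+2m) (≡0⇒≤ fT0))
  ...   | inj₂ (_ , f12) | inj₂ (_ , fT6) = ⊥-elim (¬confined-low L (≤-trans (≤-reflexive f12) 2≤7+2m) (≤-trans (≤-reflexive fT6) (n≤1+n _)))

module CandidatesHamiltonian (m : ℕ) where
  open Normalised m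
  open Candidates m

  module _ (u : Bool) (s c : ℕ) (1≤s : 1 ≤ s) (s<c : s < c) (cM : suc c ≤ 10 + 5 * m) where
    g : ℕ → ℕ
    g = chordCycle u s c

    2≤c : 2 ≤ c
    2≤c = ≤-trans (s≤s 1≤s) s<c

    gleft : ∀ y → 1 ≤ y → suc y ≤ s → g (suc y) ≡ y
    gleft (suc y) _ h = chordCycle-left u s c y h

    gmid : ∀ x → s < x → x < c → g x ≡ suc x
    gmid (suc (suc y)) h1 h2 = chordCycle-middle u s c y h1 h2
    gmid (suc zero) (s≤s h1) _ = ⊥-elim (<⇒≱ 1≤s h1)
    gmid zero () _

    gright : ∀ y → suc c ≤ y → g (suc y) ≡ y
    gright y h = chordCycle-right u s c y s<c h

    gc : g c ≡ (if u then s else 0)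
    gc = chordCycle-c u s c 2≤c s<c

    gc1 : g (suc c) ≡ (if u then 0 else suc s)
    gc1 = chordCycle-1+c u s c (≤-trans (s≤s z≤n) 2≤c) s<c

    chordCycle-regions : (P : ℕ → Set) → P 0 → P 1 → (∀ y → 1 ≤ y → suc y ≤ s → P (suc y)) → (∀ x → s < x → x < c → P x) →
          P c → P (suc c) → (∀ y → suc c ≤ y → P (suc y)) → ∀ x → P x
    chordCycle-regions P p0 p1 pL pM pc pc1 pR zero = p0
    chordCycle-regions P p0 p1 pL pM pc pc1 pR (suc zero) = p1
    chordCycle-regions P p0 p1 pL pM pc pc1 pR (suc (suc y)) with suc (suc y) ≤? s
    ... | yes h = pL (suc y) (s≤s z≤n) h
    ... | no ¬h with suc (suc y) <? c
    ...   | yes h2 = pM _ (≰⇒> ¬h) h2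
    ...   | no ¬h2 with m≤n⇒m<n∨m≡n (≮⇒≥ ¬h2)
    ...     | inj₂ refl = pc
    ...     | inj₁ c<x with m≤n⇒m<n∨m≡n c<x
    ...       | inj₂ refl = pc1
    ...       | inj₁ c1<x = pR (suc y) (≤-pred c1<x)

    chordCycle-arcs : Arc 0 (if u then suc s else s) → Arc c (if u then s else 0) → Arc (suc c) (if u then 0 else suc s) →
           ∀ x → x ≤ 10 + 5 * m → Arc x (g x)
    chordCycle-arcs a0 ac ac1 = chordCycle-regions (λ x → x ≤ 10 + 5 * m → Arc x (g x)) (λ _ → a0) (λ _ → wrap⁺ refl refl)
      (λ y h1 h2 hM → subst (Arc (suc y)) (sym (gleft y h1 h2)) (step⁻ h1 hM refl))
      (λ x h1 h2 hM → subst (Arc x) (sym (gmid x h1 h2)) (step⁺ (≤-trans (s≤s z≤n) h1) (<-≤-trans h2 (≤-trans (n≤1+n c) cM)) refl))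
      (λ _ → subst (Arc c) (sym gc) ac) (λ _ → subst (Arc (suc c)) (sym gc1) ac1)
      (λ y h1 hM → subst (Arc (suc y)) (sym (gright y h1)) (step⁻ (≤-trans (s≤s z≤n) h1) hM refl))

    chordCycle-reachesᵗ : u ≡ true → ∀ x → x ≤ 10 + 5 * m → Reaches g 0 x
    chordCycle-reachesᵗ refl = chordCycle-regions (λ x → x ≤ 10 + 5 * m → Reaches g 0 x) (λ _ → reaches-refl) (λ _ → toL 1 ≤-refl 1≤s)
      (λ y h1 h2 _ → toL (suc y) (s≤s z≤n) h2)
      (λ x h1 h2 _ → reaches-trans A (ascending⇒reaches (suc s) x (λ z a b → gmid z a (<-trans b h2)) h1))
      (λ _ → AB) (λ _ → toR (suc c) ≤-refl cM)
      (λ y h1 hM → toR (suc y) (≤-trans h1 (n≤1+n _)) hM)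
      where
      A : Reaches g 0 (suc s)
      A = reaches-step refl
      AB : Reaches g 0 c
      AB = reaches-trans A (ascending⇒reaches (suc s) c gmid s<c)
      toL : ∀ j → 1 ≤ j → j ≤ s → Reaches g 0 j
      toL j h1 h2 = reaches-trans AB (reaches-trans (reaches-step gc) (descending⇒reaches j s (λ y a b → gleft y (≤-trans h1 a) b) h2))
      toR : ∀ j → suc c ≤ j → j ≤ 10 + 5 * m → Reaches g 0 j
      toR j h hM = reaches-trans (toL 1 ≤-refl 1≤s) (reaches-trans (reaches-step refl) (descending⇒reaches j (10 + 5 * m) (λ y a b → gright y (≤-trans h a)) hM))

    chordCycle-reachesᶠ : u ≡ false → ∀ x → x ≤ 10 + 5 * m → Reaches g 0 x
    chordCycle-reachesᶠ refl = chordCycle-regions (λ x → x ≤ 10 + 5 * m → Reaches g 0 x) (λ _ → reaches-refl) (λ _ → toL 1 ≤-refl 1≤s)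
      (λ y h1 h2 _ → toL (suc y) (s≤s z≤n) h2)
      (λ x h1 h2 _ → toM x h1 (<⇒≤ h2))
      (λ _ → toM c s<c ≤-refl) (λ _ → toR (suc c) ≤-refl cM)
      (λ y h1 hM → toR (suc y) (≤-trans h1 (n≤1+n _)) hM)
      where
      toL : ∀ j → 1 ≤ j → j ≤ s → Reaches g 0 j
      toL j h1 h2 = reaches-trans (reaches-step refl) (descending⇒reaches j s (λ y a b → gleft y (≤-trans h1 a) b) h2)
      toR : ∀ j → suc c ≤ j → j ≤ 10 + 5 * m → Reaches g 0 j
      toR j h hM = reaches-trans (toL 1 ≤-refl 1≤s) (reaches-trans (reaches-step refl) (descending⇒reaches j (10 + 5 * m) (λ y a b → gright y (≤-trans h a)) hM))
      toM : ∀ x → s < x → x ≤ c → Reaches g 0 x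
      toM x h hxc = reaches-trans (toR (suc c) ≤-refl cM) (reaches-trans (reaches-step gc1) (ascending⇒reaches (suc s) x (λ z a b → gmid z a (<-≤-trans b hxc)) h))

    chordCycle-returnsᵗ : u ≡ true → ∃ λ p → iter g (suc p) 0 ≡ 0
    chordCycle-returnsᵗ refl with chordCycle-reachesᵗ refl (suc c) cM
    ... | k , e = k , trans (cong g e) gc1

    chordCycle-returnsᶠ : u ≡ false → ∃ λ p → iter g (suc p) 0 ≡ 0
    chordCycle-returnsᶠ refl with chordCycle-reachesᶠ refl c (≤-trans (n≤1+n c) cM)
    ... | k , e = k , trans (cong g e) gc

    chordCycle-to-vᵗ : u ≡ true → ∀ z → g z ≡ 0 → z ≡ suc c
    chordCycle-to-vᵗ refl = chordCycle-regions (λ z → g z ≡ 0 → z ≡ suc c) (λ ()) (λ ())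
      (λ y h1 h2 e → ⊥-elim (<⇒≢ h1 (sym (trans (sym (gleft y h1 h2)) e))))
      (λ x h1 h2 e → ⊥-elim (1+n≢0 (trans (sym (gmid x h1 h2)) e)))
      (λ e → ⊥-elim (<⇒≢ 1≤s (sym (trans (sym gc) e))))
      (λ _ → refl)
      (λ y h e → ⊥-elim (<⇒≢ (≤-trans (s≤s z≤n) h) (sym (trans (sym (gright y h)) e))))

    chordCycle-to-vᶠ : u ≡ false → ∀ z → g z ≡ 0 → z ≡ c
    chordCycle-to-vᶠ refl = chordCycle-regions (λ z → g z ≡ 0 → z ≡ c) (λ e → ⊥-elim (<⇒≢ 1≤s (sym e))) (λ ())
      (λ y h1 h2 e → ⊥-elim (<⇒≢ h1 (sym (trans (sym (gleft y h1 h2)) e))))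
      (λ x h1 h2 e → ⊥-elim (1+n≢0 (trans (sym (gmid x h1 h2)) e)))
      (λ _ → refl)
      (λ e → ⊥-elim (1+n≢0 (trans (sym gc1) e)))
      (λ y h e → ⊥-elim (<⇒≢ (≤-trans (s≤s z≤n) h) (sym (trans (sym (gright y h)) e))))

  cycle₁-to-v : ∀ z → z ≤ M → cycle₁ z ≡ 0 → z ≡ M
  cycle₁-to-v zero _ ()
  cycle₁-to-v (suc x) h e with m≤n⇒m<n∨m≡n h
  ... | inj₁ lt = ⊥-elim (1+n≢0 (trans (sym (cycle₁-step x lt)) e))
  ... | inj₂ eq = eq

  cycle₂-to-v : ∀ z → z ≤ M → cycle₂ z ≡ 0 → z ≡ 1
  cycle₂-to-v zero _ ()
  cycle₂-to-v (suc zero) _ _ = refl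
  cycle₂-to-v (suc (suc zero)) _ ()
  cycle₂-to-v (suc (suc (suc x))) h e with m≤n⇒m<n∨m≡n h
  ... | inj₁ lt = ⊥-elim (1+n≢0 (trans (sym (cycle₂-step x lt)) e))
  ... | inj₂ refl = ⊥-elim (1+n≢0 (trans (sym cycle₂-M) e))

  cycleₙ-to-v : ∀ z → cycleₙ z ≡ 0 → z ≡ 8 + 2 * m
  cycleₙ-to-v zero ()
  cycleₙ-to-v (suc zero) ()
  cycleₙ-to-v (suc (suc y)) e with suc (suc y) ≤? 7 + 2 * m
  ... | yes h = ⊥-elim (1+n≢0 (trans (sym (cycleₙ-left y h)) e))
  ... | no h with m≤n⇒m<n∨m≡n (≰⇒> h)
  ...   | inj₂ eq = sym eq
  ...   | inj₁ lt = ⊥-elim (1+n≢0 (trans (sym (cycleₙ-right (suc y) (≤-pred lt))) e))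

  SpanningCycle : (ℕ → ℕ) → Set
  SpanningCycle g = (∀ x → x ≤ 10 + 5 * m → Arc x (g x)) × (∀ j → j ≤ 10 + 5 * m → Reaches g 0 j) × (∃ λ p → iter g (suc p) 0 ≡ 0)

  cycle₁-spanning : SpanningCycle cycle₁
  cycle₁-spanning = arcs , reach , cyc0
    where
    arcs : ∀ x → x ≤ 10 + 5 * m → Arc x (cycle₁ x)
    arcs zero _ = enter 0 z≤n refl refl
    arcs (suc x) h with m≤n⇒m<n∨m≡n h
    ... | inj₁ lt = subst (Arc (suc x)) (sym (cycle₁-step x lt)) (step⁺ (s≤s z≤n) lt refl)
    ... | inj₂ refl = subst (Arc (suc x)) (sym cycle₁-M) (leave 0 z≤n (tail₁ refl refl) refl)
    reach : ∀ j → j ≤ 10 + 5 * m → Reaches cycle₁ 0 j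
    reach zero _ = reaches-refl
    reach (suc j) h = reaches-trans (reaches-step refl) (ascending⇒reaches 1 (suc j) H (s≤s z≤n))
      where H : ∀ x → 1 ≤ x → x < suc j → cycle₁ x ≡ suc x
            H (suc x) _ lt = cycle₁-step x (<-≤-trans lt h)
    cyc0 : ∃ λ p → iter cycle₁ (suc p) 0 ≡ 0
    cyc0 with reach (10 + 5 * m) ≤-refl
    ... | k , e = k , trans (cong cycle₁ e) cycle₁-M

  cycle₂-spanning : SpanningCycle cycle₂
  cycle₂-spanning = arcs , reach , cyc0
    where
    arcs : ∀ x → x ≤ 10 + 5 * m → Arc x (cycle₂ x)
    arcs zero _ = enter 1 (s≤s z≤n) refl refl
    arcs (suc zero) _ = leave 1 (s≤s z≤n) (tail₂ refl refl) refl
    arcs (suc (suc zero)) _ = step⁻ (s≤s z≤n) (s≤s (s≤s z≤n)) refl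
    arcs (suc (suc (suc x))) h with m≤n⇒m<n∨m≡n h
    ... | inj₁ lt = subst (Arc (3 + x)) (sym (cycle₂-step x lt)) (step⁺ (s≤s z≤n) lt refl)
    ... | inj₂ refl = subst (Arc (3 + x)) (sym cycle₂-M) (extB′ refl refl)
    toM : ∀ j → 3 ≤ j → j ≤ 10 + 5 * m → Reaches cycle₂ 0 j
    toM j h1 h2 = reaches-trans (reaches-step refl) (ascending⇒reaches 3 j H h1)
      where H : ∀ x → 3 ≤ x → x < j → cycle₂ x ≡ suc x
            H (suc (suc (suc x))) _ lt = cycle₂-step x (<-≤-trans lt h2)
            H (suc zero) (s≤s ()) _
            H (suc (suc zero)) (s≤s (s≤s ())) _
    r2 : Reaches cycle₂ 0 2
    r2 = reaches-trans (toM (10 + 5 * m) (s≤s (s≤s (s≤s z≤n))) ≤-refl) (reaches-step cycle₂-M)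
    reach : ∀ j → j ≤ 10 + 5 * m → Reaches cycle₂ 0 j
    reach zero _ = reaches-refl
    reach (suc zero) _ = reaches-trans r2 (reaches-step refl)
    reach (suc (suc zero)) _ = r2
    reach (suc (suc (suc j))) h = toM (3 + j) (s≤s (s≤s (s≤s z≤n))) h
    cyc0 : ∃ λ p → iter cycle₂ (suc p) 0 ≡ 0
    cyc0 with reach 1 (s≤s z≤n)
    ... | k , e = k , cong cycle₂ e

  cycleₙ-spanning : SpanningCycle cycleₙ
  cycleₙ-spanning = arcs , reach , cyc0
    where
    TM : 7 + 2 * m ≤ 10 + 5 * m
    TM = ≤-trans (n≤1+n _) (ArcShapes.8+2m≤M m)
    lem : ∀ m → 7 + 2 * m ≡ 1 + 2 * (3 + m)
    lem = solve-∀
    arcs : ∀ x → x ≤ 10 + 5 * m → Arc x (cycleₙ x)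
    arcs zero _ = enter (3 + m) ≤-refl refl (lem m)
    arcs (suc zero) _ = wrap⁺ refl refl
    arcs (suc (suc y)) h with suc (suc y) ≤? 7 + 2 * m
    ... | yes h2 = subst (Arc (suc (suc y))) (sym (cycleₙ-left y h2)) (step⁻ (s≤s z≤n) (<-≤-trans h2 TM) refl)
    ... | no h2 with m≤n⇒m<n∨m≡n (≰⇒> h2)
    ...   | inj₂ refl = subst (Arc (8 + 2 * m)) (sym cycleₙ-8+2m) (leave (3 + m) ≤-refl (tailₙ refl refl) refl)
    ...   | inj₁ lt = subst (Arc (suc (suc y))) (sym (cycleₙ-right (suc y) (≤-pred lt))) (step⁻ (s≤s z≤n) h refl)
    toL : ∀ j → 1 ≤ j → j ≤ 7 + 2 * m → Reaches cycleₙ 0 j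
    toL j h1 h2 = reaches-trans (reaches-step refl) (descending⇒reaches j (7 + 2 * m) H h2)
      where H : ∀ y → j ≤ y → y < 7 + 2 * m → cycleₙ (suc y) ≡ y
            H (suc y) _ lt = cycleₙ-left y lt
            H zero a _ = ⊥-elim (<⇒≱ h1 a)
    toR : ∀ j → 8 + 2 * m ≤ j → j ≤ 10 + 5 * m → Reaches cycleₙ 0 j
    toR j h1 h2 = reaches-trans (toL 1 (s≤s z≤n) (s≤s z≤n))
      (reaches-trans (reaches-step refl) (descending⇒reaches j (10 + 5 * m) (λ y a _ → cycleₙ-right y (≤-trans h1 a)) h2))
    reach : ∀ j → j ≤ 10 + 5 * m → Reaches cycleₙ 0 j
    reach zero _ = reaches-refl
    reach (suc j) h with suc j ≤? 7 + 2 * m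
    ... | yes h2 = toL (suc j) (s≤s z≤n) h2
    ... | no h2 = toR (suc j) (≰⇒> h2) h
    cyc0 : ∃ λ p → iter cycleₙ (suc p) 0 ≡ 0
    cyc0 with reach (8 + 2 * m) (ArcShapes.8+2m≤M m)
    ... | k , e = k , trans (cong cycleₙ e) cycleₙ-8+2m

  chordB-source+3i≡M : ∀ {i} → suc i ≤ chordsB → M ∸ 3 * suc i + 3 * suc i ≡ M
  chordB-source+3i≡M i≤ = m∸n+n≡m (3i≤M (≤-trans i≤ chordsB≤m))

  chordCycleB-s<c : ∀ {i} → suc i ≤ chordsB → 2 * suc (suc i) < M ∸ 3 * suc i
  chordCycleB-s<c {i} i≤ =
    ≤-trans (s≤s (≤-trans (≤-reflexive (*-distribˡ-+ 2 1 (suc i))) (+-monoʳ-≤ 2 (*-monoʳ-≤ 2 (≤-trans i≤ chordsB≤m)))))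
      (≤-trans (m≤n+m _ 7) (ArcShapes.chordB-source≥10+2m m (chordB-source+3i≡M i≤) i≤))

  chordCycleB-1+c≤M : ∀ {i} → suc i ≤ chordsB → suc (M ∸ 3 * suc i) ≤ M
  chordCycleB-1+c≤M i≤ = ≤-trans (m<m+n _ (s≤s z≤n)) (≤-reflexive (chordB-source+3i≡M i≤))

  chordCycleA-s<c : ∀ {l i'} → l + i' ≡ 2 + m → 1 + 2 * l < 7 + 2 * m + 3 * i'
  chordCycleA-s<c {l} {i'} li =
    ≤-trans (s≤s (s≤s (≤-trans (*-monoʳ-≤ 2 (≤-trans (m≤m+n l i') (≤-reflexive li))) (≤-reflexive (*-distribˡ-+ 2 2 m)))))
      (≤-trans (n≤1+n _) (m≤m+n _ _))

  chordCycleA-1+c≤M : ∀ {i'} → i' ≤ chordsA → suc (7 + 2 * m + 3 * i') ≤ M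
  chordCycleA-1+c≤M i'≤ = ≤-trans (+-monoʳ-≤ (8 + 2 * m) (*-monoʳ-≤ 3 (≤-trans i'≤ chordsA≤m))) (lem m)
    where lem : ∀ m → 8 + 2 * m + 3 * m ≤ 10 + 5 * m
          lem m = subst (8 + 2 * m + 3 * m ≤_) (lem′ m) (m≤m+n _ 2)
            where lem′ : ∀ m → 8 + 2 * m + 3 * m + 2 ≡ 10 + 5 * m
                  lem′ = solve-∀

  chordsB+2≤label : ∀ i → ¬ (suc i ≤ chordsB) → chordsB + 2 ≤ suc (suc i)
  chordsB+2≤label i ¬i≤ = subst (_≤ suc (suc i)) (+-comm 2 chordsB) (s≤s (s≤s (≤-pred (≰⇒> ¬i≤))))

  2+m∸label≤chordsA : ∀ {l} → chordsB + 2 ≤ l → 2 + m ∸ l ≤ chordsA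
  2+m∸label≤chordsA F2≤ = ≤-trans (∸-monoʳ-≤ (2 + m) F2≤) (≤-reflexive (begin
    2 + m ∸ (chordsB + 2)                     ≡⟨ cong (λ z → 2 + z ∸ (chordsB + 2)) chordsB+chordsA≡m ⟨
    2 + (chordsB + chordsA) ∸ (chordsB + 2)   ≡⟨ cong (_∸ (chordsB + 2)) (lem chordsB chordsA) ⟩
    chordsA + (chordsB + 2) ∸ (chordsB + 2)   ≡⟨ m+n∸n≡m chordsA (chordsB + 2) ⟩
    chordsA                                   ∎))
    where
    open ≡-Reasoning
    lem : ∀ a b → 2 + (a + b) ≡ b + (a + 2)
    lem = solve-∀

  chordCycleB-spanning : ∀ i → suc i ≤ chordsB → SpanningCycle (chordCycle true (2 * suc (suc i)) (M ∸ 3 * suc i))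
  chordCycleB-spanning i i≤ =
    chordCycle-arcs true s c (s≤s z≤n) s<c cM
      (enter (suc (suc i)) lb refl refl)
      (chordB′ i i≤ (chordB-source+3i≡M i≤) (*-distribˡ-+ 2 1 (suc i)))
      (leave (suc (suc i)) lb (tailA i i≤ refl (cong suc (chordB-source+3i≡M i≤))) refl) ,
    chordCycle-reachesᵗ true s c (s≤s z≤n) s<c cM refl ,
    chordCycle-returnsᵗ true s c (s≤s z≤n) s<c cM refl
    where
    s c : ℕ
    s = 2 * suc (suc i)
    c = M ∸ 3 * suc i
    s<c : s < c
    s<c = chordCycleB-s<c i≤
    cM : suc c ≤ M
    cM = chordCycleB-1+c≤M i≤
    lb : suc (suc i) ≤ 3 + m
    lb = ≤-trans (s≤s (≤-trans i≤ chordsB≤m)) (≤-trans (n≤1+n _) (n≤1+n _))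

  chordCycleA-spanning : ∀ l i' → l + i' ≡ 2 + m → i' ≤ chordsA → SpanningCycle (chordCycle false (1 + 2 * l) (7 + 2 * m + 3 * i'))
  chordCycleA-spanning l i' li i'≤ =
    chordCycle-arcs false s c (s≤s z≤n) s<c cM (enter l l≤ refl refl) (leaves-c i' li i'≤) (chord-from-1+c i' li i'≤) ,
    chordCycle-reachesᶠ false s c (s≤s z≤n) s<c cM refl ,
    chordCycle-returnsᶠ false s c (s≤s z≤n) s<c cM refl
    where
    s c : ℕ
    s = 1 + 2 * l
    c = 7 + 2 * m + 3 * i'
    s<c : s < c
    s<c = chordCycleA-s<c {l} {i'} li
    cM : suc c ≤ M
    cM = chordCycleA-1+c≤M i'≤
    l≤ : l ≤ 3 + m
    l≤ = ≤-trans (m≤m+n l i') (≤-trans (≤-reflexive li) (n≤1+n _))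
    2+2[2+m]≡6+2m : 2 + 2 * (2 + m) ≡ 6 + 2 * m
    2+2[2+m]≡6+2m = cong (2 +_) (*-distribˡ-+ 2 2 m)
    leaves-c : ∀ i' → l + i' ≡ 2 + m → i' ≤ chordsA → Arc (7 + 2 * m + 3 * i') 0
    leaves-c zero li _ = leave l l≤ (tailₙ₋₁ (trans (sym (+-identityʳ l)) li) (+-identityʳ _)) refl
    leaves-c (suc i) li i≤ = leave l l≤ (tailB i i≤ li refl) refl
    chord-from-1+c : ∀ i' → l + i' ≡ 2 + m → i' ≤ chordsA → Arc (suc (7 + 2 * m + 3 * i')) (suc s)
    chord-from-1+c zero li _ =
      extA′ (cong suc (+-identityʳ _)) (trans (cong (λ z → 2 + 2 * z) (trans (sym (+-identityʳ l)) li)) 2+2[2+m]≡6+2m)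
    chord-from-1+c (suc i) li i≤ =
      chordA′ i i≤ refl (trans (lem l i) (trans (cong (λ z → 2 + 2 * z) li) 2+2[2+m]≡6+2m))
      where lem : ∀ l i → suc (1 + 2 * l) + 2 * suc i ≡ 2 + 2 * (l + suc i)
            lem = solve-∀

  hamCycle-spanning : ∀ l → l ≤ 3 + m → SpanningCycle (hamCycle l)
  hamCycle-spanning zero _ = cycle₁-spanning
  hamCycle-spanning (suc zero) _ = cycle₂-spanning
  hamCycle-spanning (suc (suc i)) l≤ with suc i ≤? chordsB
  ... | yes i≤ = subst SpanningCycle (sym (hamCycle-chordB i i≤)) (chordCycleB-spanning i i≤)
  ... | no ¬i≤ with m≤n⇒m<n∨m≡n l≤
  ...   | inj₂ e = subst SpanningCycle (sym (trans (cong hamCycle e) hamCycle-last)) cycleₙ-spanning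
  ...   | inj₁ lt = subst SpanningCycle (sym (hamCycle-chordA (suc (suc i)) F2≤ lt))
                      (chordCycleA-spanning (suc (suc i)) (2 + m ∸ suc (suc i)) (m+[n∸m]≡n (≤-pred lt)) (2+m∸label≤chordsA F2≤))
    where
    F2≤ : chordsB + 2 ≤ suc (suc i)
    F2≤ = chordsB+2≤label i ¬i≤

module CandidateLabels (m : ℕ) where
  open Normalised m
  open Candidates m
  open TailPositions m
  open CandidatesHamiltonian m

  hamCycle-0 : ∀ l → l ≤ 3 + m → hamCycle l 0 ≡ 1 + 2 * l
  hamCycle-0 zero _ = refl
  hamCycle-0 (suc zero) _ = refl
  hamCycle-0 (suc (suc i)) l≤ with suc i ≤? chordsB
  ... | yes i≤ = cong (λ g → g 0) (hamCycle-chordB i i≤)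
  ... | no ¬i≤ with m≤n⇒m<n∨m≡n l≤
  ...   | inj₂ e = trans (cong (λ l → hamCycle l 0) e)
                     (trans (cong (λ g → g 0) hamCycle-last) (trans (sym (cong suc (*-distribˡ-+ 2 3 m))) (cong (λ l → 1 + 2 * l) (sym e))))
  ...   | inj₁ lt = cong (λ g → g 0) (hamCycle-chordA (suc (suc i)) (chordsB+2≤label i ¬i≤) lt)

  hamCycle-tail-label : ∀ l → l ≤ 3 + m → ∀ z → z ≤ M → hamCycle l z ≡ 0 → ∀ {l'} → Tail l' z → l' ≡ l
  hamCycle-tail-label zero _ z zM e t = tail-at-M (subst (Tail _) (cycle₁-to-v z zM e) t)
  hamCycle-tail-label (suc zero) _ z zM e t = tail-at-1 (subst (Tail _) (cycle₂-to-v z zM e) t)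
  hamCycle-tail-label (suc (suc i)) l≤ z zM e t with suc i ≤? chordsB
  ... | yes i≤ =
    tail-at-1+chordB-source i i≤ (M ∸ 3 * suc i) (chordB-source+3i≡M i≤)
      (subst (Tail _) (chordCycle-to-vᵗ true _ _ (s≤s z≤n) (chordCycleB-s<c i≤) (chordCycleB-1+c≤M i≤) refl z
                          (trans (cong (λ g → g z) (sym (hamCycle-chordB i i≤))) e)) t)
  ... | no ¬i≤ with m≤n⇒m<n∨m≡n l≤
  ...   | inj₂ eq =
    trans (tail-at-8+2m (subst (Tail _) (cycleₙ-to-v z (trans (cong (λ g → g z) (sym (trans (cong hamCycle eq) hamCycle-last))) e)) t))
      (sym eq)
  ...   | inj₁ lt =
    tail-at-7+2m+3i (suc (suc i)) (2 + m ∸ suc (suc i)) li i'≤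
      (subst (Tail _) (chordCycle-to-vᶠ false _ _ (s≤s z≤n) (chordCycleA-s<c {suc (suc i)} li) (chordCycleA-1+c≤M i'≤) refl z
                          (trans (cong (λ g → g z) (sym (hamCycle-chordA (suc (suc i)) F2≤ lt))) e)) t)
    where
    F2≤ : chordsB + 2 ≤ suc (suc i)
    F2≤ = chordsB+2≤label i ¬i≤
    li : suc (suc i) + (2 + m ∸ suc (suc i)) ≡ 2 + m
    li = m+[n∸m]≡n (≤-pred lt)
    i'≤ : 2 + m ∸ suc (suc i) ≤ chordsA
    i'≤ = 2+m∸label≤chordsA F2≤

-- Vertices of D n as natural numbers 0 .. M; out-of-range numbers are sent to v.
module Encoding (m : ℕ) where
  open Normalised m
  open ArcShapes m
  open Candidates m
  open CandidatesHamiltonian m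
  open CandidateLabels m

  N : ℕ
  N = nV n

  N≡1+M : N ≡ suc M
  N≡1+M = 5n∸9≡

  toℕ≤M : (i : Fin N) → toℕ i ≤ M
  toℕ≤M i = ≤-pred (subst (toℕ i <_) N≡1+M (toℕ<n i))

  toFin : ℕ → Fin N
  toFin x with x <? N
  ... | yes p = fromℕ< p
  ... | no _ = subst Fin (sym N≡1+M) Fin.zero

  toℕ-toFin : ∀ x → x ≤ M → toℕ (toFin x) ≡ x
  toℕ-toFin x x≤M with x <? N
  ... | yes p = toℕ-fromℕ< p
  ... | no x≮N = ⊥-elim (x≮N (subst (x <_) (sym N≡1+M) (s≤s x≤M)))

  toFin-toℕ : ∀ (i : Fin N) → toFin (toℕ i) ≡ i
  toFin-toℕ i = toℕ-injective (toℕ-toFin (toℕ i) (toℕ≤M i))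

  hamTable : ℕ → Vec (Fin N) N
  hamTable l = tabulate (λ i → toFin (hamCycle l (toℕ i)))

  lookup-hamTable : ∀ l → l ≤ 3 + m → ∀ i → toℕ (lookup (hamTable l) i) ≡ hamCycle l (toℕ i)
  lookup-hamTable l l≤ i =
    trans (cong toℕ (lookup∘tabulate _ i)) (toℕ-toFin _ (arc-target≤M (proj₁ (hamCycle-spanning l l≤) (toℕ i) (toℕ≤M i))))

  hamTable-isHamCycle : ∀ l → l ≤ 3 + m → IsHamCycle (D n) (hamTable l)
  hamTable-isHamCycle l l≤ = edges , surjective⇒injective G surjective , orbit
    where
    G : Fin N → Fin N
    G = lookup (hamTable l)
    arcs : ∀ x → x ≤ M → Arc x (hamCycle l x)
    arcs = proj₁ (hamCycle-spanning l l≤)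
    reaches : ∀ x → x ≤ M → Reaches (hamCycle l) 0 x
    reaches = proj₁ (proj₂ (hamCycle-spanning l l≤))
    returns : ∃ λ q → iter (hamCycle l) (suc q) 0 ≡ 0
    returns = proj₂ (proj₂ (hamCycle-spanning l l≤))
    edges : ∀ i → D n i (G i)
    edges i = subst (DArc n (toℕ i)) (sym (lookup-hamTable l l≤ i)) (fromArc (arcs (toℕ i) (toℕ≤M i)))
    orbit : ∀ i j → ∃ λ k → iter G k i ≡ j
    orbit i j = lift (reaches-within-cycle (reaches (toℕ i) (toℕ≤M i)) (reaches (toℕ j) (toℕ≤M j)) returns)
      where
      lift : Reaches (hamCycle l) (toℕ i) (toℕ j) → ∃ λ k → iter G k i ≡ j
      lift (k , e) = k , toℕ-injective (trans (toℕ-iter G (hamCycle l) (lookup-hamTable l l≤) k i) e)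
    surjective : ∀ j → ∃ λ i → G i ≡ j
    surjective = orbit⇒surjective G orbit

  successor : Vec (Fin N) N → ℕ → ℕ
  successor s x = toℕ (lookup s (toFin x))

  successor-toℕ : ∀ s i → successor s (toℕ i) ≡ toℕ (lookup s i)
  successor-toℕ s i = cong (λ j → toℕ (lookup s j)) (toFin-toℕ i)

  successor-isHamSuccessor : ∀ {s} → IsHamCycle (D n) s → IsHamSuccessor m (successor s)
  successor-isHamSuccessor {s} (edges , injective , orbit) = record
    { f-arc       = λ x x≤M → subst (λ z → Arc z (successor s x)) (toℕ-toFin x x≤M) (toArc (edges (toFin x)))
    ; f-bounded   = λ x _ → toℕ≤M _
    ; f-injective = λ x y x≤M y≤M e →
        trans (sym (toℕ-toFin x x≤M)) (trans (cong toℕ (injective _ _ (toℕ-injective e))) (toℕ-toFin y y≤M))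
    ; f-orbit     = f-orbit
    }
    where
    f-orbit : ∀ x y → x ≤ M → y ≤ M → ∃ λ k → iter (successor s) k x ≡ y
    f-orbit x y x≤M y≤M = lift (orbit (toFin x) (toFin y))
      where
      lift : (∃ λ k → iter (lookup s) k (toFin x) ≡ toFin y) → ∃ λ k → iter (successor s) k x ≡ y
      lift (k , e) = k , (begin
        iter (successor s) k x                   ≡⟨ cong (iter (successor s) k) (toℕ-toFin x x≤M) ⟨
        iter (successor s) k (toℕ (toFin x))     ≡⟨ toℕ-iter (lookup s) (successor s) (λ i → sym (successor-toℕ s i)) k (toFin x) ⟨
        toℕ (iter (lookup s) k (toFin x))        ≡⟨ cong toℕ e ⟩
        toℕ (toFin y)                            ≡⟨ toℕ-toFin y y≤M ⟩
        y                                        ∎)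
        where open ≡-Reasoning

  hamCycle⇒hamTable : ∀ s → IsHamCycle (D n) s → ∃ λ l → l ≤ 3 + m × s ≡ hamTable l
  hamCycle⇒hamTable s H = candidate⇒hamTable (Classification.classify m (successor s) (successor-isHamSuccessor {s} H))
    where
    candidate⇒hamTable : Classification.MatchesCandidate m (successor s) (successor-isHamSuccessor {s} H) →
                         ∃ λ l → l ≤ 3 + m × s ≡ hamTable l
    candidate⇒hamTable (l , l≤ , agrees) = l , l≤ , trans (sym (tabulate∘lookup s)) (tabulate-cong entry)
      where
      entry : ∀ i → lookup s i ≡ toFin (hamCycle l (toℕ i))
      entry i = toℕ-injective (begin
        toℕ (lookup s i)                    ≡⟨ successor-toℕ s i ⟨
        successor s (toℕ i)                 ≡⟨ agrees (toℕ i) (toℕ≤M i) ⟩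
        hamCycle l (toℕ i)                  ≡⟨ toℕ-toFin _ (arc-target≤M (proj₁ (hamCycle-spanning l l≤) (toℕ i) (toℕ≤M i))) ⟨
        toℕ (toFin (hamCycle l (toℕ i)))    ∎)
        where open ≡-Reasoning

delIn-or-delOut : ∀ md → DelIn md ⊎ DelOut md
delIn-or-delOut delIn = inj₁ tt
delIn-or-delOut delOut = inj₂ tt
delIn-or-delOut delBoth = inj₁ tt

module Counting (m : ℕ) where
  open Normalised m
  open ArcShapes m
  open Candidates m
  open CandidatesHamiltonian m
  open CandidateLabels m
  open Encoding m

  IsCrownArc : ∀ {a b} → Arc a b → Set
  IsCrownArc (enter _ _ _ _) = ⊥
  IsCrownArc (leave _ _ _ _) = ⊥
  IsCrownArc _ = ⊤

  toArc-crown : ∀ {a b} (c : CrownEdge n a b) → IsCrownArc (toArc (crown c))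
  toArc-crown (fwd _ _ _ refl refl) = tt
  toArc-crown (bwd _ _ _ refl refl) = tt
  toArc-crown (wrapF _ _) = tt
  toArc-crown (wrapB _ _) = tt
  toArc-crown (extA _ _) = tt
  toArc-crown (extB _ _) = tt
  toArc-crown (chordA (suc i) _ _ _ _) = tt
  toArc-crown (chordB (suc i) _ _ _ _) = tt

  crownArc-target≢v : ∀ {x} → (a : Arc x 0) → IsCrownArc a → ⊥
  crownArc-target≢v (step⁺ _ _ ())
  crownArc-target≢v (step⁻ () _ _)
  crownArc-target≢v (wrap⁺ _ ())
  crownArc-target≢v (wrap⁻ _ ())
  crownArc-target≢v (extA′ _ ())
  crownArc-target≢v (extB′ _ ())
  crownArc-target≢v (chordA′ i i≤ _ e) _ =
    <⇒≱ (≤-trans (s≤s (*-monoʳ-≤ 2 (≤-trans i≤ chordsA≤m))) (m≤n+m _ 5)) (≤-reflexive (sym e))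
  crownArc-target≢v (chordB′ _ _ _ ())

  crownArc-source≢v : ∀ {y} → (a : Arc 0 y) → IsCrownArc a → ⊥
  crownArc-source≢v (step⁺ () _ _)
  crownArc-source≢v (step⁻ _ _ ())
  crownArc-source≢v (wrap⁺ () _)
  crownArc-source≢v (wrap⁻ () _)
  crownArc-source≢v (extA′ () _)
  crownArc-source≢v (extB′ () _)
  crownArc-source≢v (chordA′ _ _ () _)
  crownArc-source≢v (chordB′ i i≤ e _) _ = ≤⇒≯ z≤n (chordB-source≥10+2m e i≤)

  crown-target≢v : ∀ {x y} → y ≡ 0 → CrownEdge n x y → ⊥
  crown-target≢v refl c = crownArc-target≢v (toArc (crown c)) (toArc-crown c)

  crown-source≢v : ∀ {x y} → x ≡ 0 → CrownEdge n x y → ⊥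
  crown-source≢v refl c = crownArc-source≢v (toArc (crown c)) (toArc-crown c)

  tail≢v : ∀ {l} → ¬ OutTail n (suc l) 0
  tail≢v t with tail-position (toTail t)
  ... | inj₂ (inj₂ ())

  toℕ≤3+m : (j : Fin n) → toℕ j ≤ 3 + m
  toℕ≤3+m j = ≤-pred (toℕ<n j)

  hamTable-0 : ∀ l → l ≤ 3 + m → toℕ (lookup (hamTable l) (toFin 0)) ≡ 1 + 2 * l
  hamTable-0 l l≤ = trans (lookup-hamTable l l≤ (toFin 0)) (trans (cong (hamCycle l) (toℕ-toFin 0 z≤n)) (hamCycle-0 l l≤))

  hamTable-injective : ∀ {j₁ j₂ : Fin n} → hamTable (toℕ j₁) ≡ hamTable (toℕ j₂) → j₁ ≡ j₂
  hamTable-injective {j₁} {j₂} e = toℕ-injective (1+2*-injective _ _ (begin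
    1 + 2 * toℕ j₁                              ≡⟨ hamTable-0 (toℕ j₁) (toℕ≤3+m j₁) ⟨
    toℕ (lookup (hamTable (toℕ j₁)) (toFin 0))  ≡⟨ cong (λ T → toℕ (lookup T (toFin 0))) e ⟩
    toℕ (lookup (hamTable (toℕ j₂)) (toFin 0))  ≡⟨ hamTable-0 (toℕ j₂) (toℕ≤3+m j₂) ⟩
    1 + 2 * toℕ j₂                              ∎))
    where open ≡-Reasoning

  -- Label j : Fin n stands for the paper's label toℕ j + 1; the surviving candidates are those of the labels outside S.
  candidates : Subset n → List (Vec (Fin N) N)
  candidates S = map (λ j → hamTable (toℕ j)) (elements (∁ S))

  module Broken (S : Subset n) (mode : Fin n → Mode) where

    hamTable-edges-kept : ∀ (j : Fin n) → ¬ (j ∈ₛ S) → ∀ x → x ≤ M → ∀ y → y ≡ hamCycle (toℕ j) x →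
                          (d : DArc n x y) → Kept S mode d
    hamTable-edges-kept j j∉S x x≤M y y≡ (crown _) = tt
    hamTable-edges-kept j j∉S x x≤M y y≡ (inArc (suc l) _ _ refl b≡) (j′ , e , j′∈S , _) =
      j∉S (subst (_∈ₛ S) (toℕ-injective (trans (suc-injective e) l≡j)) j′∈S)
      where
      l≡j : l ≡ toℕ j
      l≡j = 1+2*-injective l (toℕ j)
              (trans (sym (2[1+l]∸1≡1+2l l)) (trans (sym b≡) (trans y≡ (hamCycle-0 (toℕ j) (toℕ≤3+m j)))))
    hamTable-edges-kept j j∉S x x≤M y y≡ (outArc (suc l) _ _ t b≡) (j′ , e , j′∈S , _) =
      j∉S (subst (_∈ₛ S) (toℕ-injective (trans (suc-injective e) l≡j)) j′∈S)
      where
      l≡j : l ≡ toℕ j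
      l≡j = hamCycle-tail-label (toℕ j) (toℕ≤3+m j) x x≤M (trans (sym y≡) b≡) (toTail t)

    hamTable-isHamCycleᴮ : ∀ (j : Fin n) → ¬ (j ∈ₛ S) → IsHamCycle (B n S mode) (hamTable (toℕ j))
    hamTable-isHamCycleᴮ j j∉S = edgesᴮ , proj₂ H
      where
      H : IsHamCycle (D n) (hamTable (toℕ j))
      H = hamTable-isHamCycle (toℕ j) (toℕ≤3+m j)
      edgesᴮ : ∀ i → B n S mode i (lookup (hamTable (toℕ j)) i)
      edgesᴮ i = proj₁ H i ,
        hamTable-edges-kept j j∉S (toℕ i) (toℕ≤M i) _ (lookup-hamTable (toℕ j) (toℕ≤3+m j) i) (proj₁ H i)

    in-edge-kept : ∀ l {x y} (d : DArc n x y) → x ≡ 0 → y ≡ hamCycle l 0 → l ≤ 3 + m →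
                   Kept S mode d → ¬ InDeleted S mode (suc l)
    in-edge-kept l (crown c) x≡0 _ _ _ = ⊥-elim (crown-source≢v x≡0 c)
    in-edge-kept l (inArc (suc l′) _ _ _ b≡) _ y≡ l≤ kept = subst (λ z → ¬ InDeleted S mode (suc z)) l′≡l kept
      where
      l′≡l : l′ ≡ l
      l′≡l = 1+2*-injective l′ l (trans (sym (2[1+l]∸1≡1+2l l′)) (trans (sym b≡) (trans y≡ (hamCycle-0 l l≤))))
    in-edge-kept l (outArc (suc _) _ _ t _) refl _ _ _ = ⊥-elim (tail≢v t)

    out-edge-kept : ∀ l {x y} (d : DArc n x y) → x ≤ M → y ≡ 0 → hamCycle l x ≡ 0 → l ≤ 3 + m →
                    Kept S mode d → ¬ OutDeleted S mode (suc l)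
    out-edge-kept l (crown c) _ y≡0 _ _ _ = ⊥-elim (crown-target≢v y≡0 c)
    out-edge-kept l (inArc (suc l′) _ _ _ b≡) _ y≡0 _ _ _ = ⊥-elim (1+n≢0 (trans (sym (2[1+l]∸1≡1+2l l′)) (trans (sym b≡) y≡0)))
    out-edge-kept l (outArc (suc l′) _ _ t _) x≤M _ into-v l≤ kept =
      subst (λ z → ¬ OutDeleted S mode (suc z)) (hamCycle-tail-label l l≤ _ x≤M into-v (toTail t)) kept

    -- A Hamiltonian cycle of B n S mode uses both edges of its label, so that label is not in S.
    label-unused : ∀ l (l≤ : l ≤ 3 + m) → IsHamCycle (B n S mode) (hamTable l) → ¬ (fromℕ< (s≤s l≤) ∈ₛ S)
    label-unused l l≤ H j∈S = [ in-deleted , out-deleted ] (delIn-or-delOut (mode j))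
      where
      j : Fin n
      j = fromℕ< (s≤s l≤)
      label≡ : suc (toℕ j) ≡ suc l
      label≡ = cong suc (toℕ-fromℕ< (s≤s l≤))
      G : Fin N → Fin N
      G = lookup (hamTable l)
      v : Fin N
      v = toFin 0
      into-v : ∃ λ i → G i ≡ v
      into-v = orbit⇒surjective G (proj₂ (proj₂ H)) v
      in-deleted : DelIn (mode j) → ⊥
      in-deleted del = in-edge-kept l (proj₁ (proj₁ H v)) (toℕ-toFin 0 z≤n)
        (trans (lookup-hamTable l l≤ v) (cong (hamCycle l) (toℕ-toFin 0 z≤n))) l≤ (proj₂ (proj₁ H v)) (j , label≡ , j∈S , del)
      out-deleted : DelOut (mode j) → ⊥
      out-deleted del = out-edge-kept l (proj₁ (proj₁ H i)) (toℕ≤M i) to-v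
        (trans (sym (lookup-hamTable l l≤ i)) to-v) l≤ (proj₂ (proj₁ H i)) (j , label≡ , j∈S , del)
        where
        i : Fin N
        i = proj₁ into-v
        to-v : toℕ (G i) ≡ 0
        to-v = trans (cong toℕ (proj₂ into-v)) (toℕ-toFin 0 z≤n)

    complete : ∀ s → IsHamCycle (B n S mode) s → s ∈ candidates S
    complete s H = found (hamCycle⇒hamTable s (isHamCycle-mono {E = B n S mode} {D n} proj₁ {s} H))
      where
      found : (∃ λ l → l ≤ 3 + m × s ≡ hamTable l) → s ∈ candidates S
      found (l , l≤ , refl) =
        subst (_∈ candidates S) (cong hamTable (toℕ-fromℕ< (s≤s l≤)))
          (∈-map⁺ (λ j → hamTable (toℕ j)) (∈-elements⁺ (x∉p⇒x∈∁p (label-unused l l≤ H))))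

    count : ∀ k → k ≤ n → ∣ S ∣ ≡ n ∸ k → HasExactlyHamCycles (B n S mode) k
    count k k≤n |S|≡ =
      candidates S ,
      trans (length-map _ (elements (∁ S))) (trans (length-elements (∁ S))
        (trans (∣∁p∣≡n∸∣p∣ S) (trans (cong (n ∸_) |S|≡) (m∸[m∸n]≡n k≤n)))) ,
      Unique.map⁺ hamTable-injective (elements-unique (∁ S)) ,
      All.map⁺ (All.tabulate (λ j∈ → hamTable-isHamCycleᴮ _ (x∈∁p⇒x∉p (∈-elements⁻ j∈)))) ,
      complete

  D-count : HasExactlyHamCycles (D n) n
  D-count = hasExactlyHamCycles-cong {E = B n ∅ (λ _ → delIn)} {D n} proj₁ (λ d → d , nothing-deleted d)
              (Broken.count ∅ (λ _ → delIn) n ≤-refl (trans (∣⊥∣≡0 n) (sym (n∸n≡0 n))))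
    where
    nothing-deleted : ∀ {a b} (d : DArc n a b) → Kept ∅ (λ _ → delIn) d
    nothing-deleted (crown _) = tt
    nothing-deleted (inArc _ _ _ _ _) (_ , _ , j∈∅ , _) = ∉⊥ j∈∅
    nothing-deleted (outArc _ _ _ _ _) (_ , _ , j∈∅ , _) = ∉⊥ j∈∅

mainTheorem2 : ∀ (n k : ℕ) → 4 ≤ k → k ≤ n →
    HasExactlyHamCycles (D n) n ×
    (∀ (S : Subset n) (mode : Fin n → Mode) → ∣ S ∣ ≡ n ∸ k →
      HasExactlyHamCycles (B n S mode) k)
mainTheorem2 (suc (suc (suc (suc m)))) k _ k≤n =
  Counting.D-count m , λ S mode |S|≡n∸k → Counting.Broken.count m S mode k k≤n |S|≡n∸k
mainTheorem2 zero _ (s≤s _) ()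
mainTheorem2 (suc zero) _ (s≤s (s≤s _)) (s≤s ())
mainTheorem2 (suc (suc zero)) _ (s≤s (s≤s (s≤s _))) (s≤s (s≤s ()))
mainTheorem2 (suc (suc (suc zero))) _ (s≤s (s≤s (s≤s (s≤s _)))) (s≤s (s≤s (s≤s ())))
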